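{- Let $n\geq 3$ and let $G$ be a connected graph on $n$ vertices with no cut vertices. Then for every $v\in V(G)$, $f_G(v)\geq\frac{n^2+n+2}{2}$, and equality holds if and only if $G\cong C_n$.
   Context: All graphs are simple, finite, undirected. $f_G(v)$ is the number of connected subgraphs of $G$ containing $v$, where a connected subgraph is a nonempty subgraph (vertex subset with a subset of edges among them) that is connected, distinct subgraphs counted separately. $C_n$ is the cycle on $n$ vertices. -}

module Defs where

open import Data.Nat using (ℕ; zero; suc; _+_; _*_; _∸_; _≡ᵇ_)
open import Data.Bool using (Bool; true; false; _∨_; _∧_)
open import Data.Fin using (Fin; toℕ)
open import Data.Vec using (Vec; lookup)
open import Data.List using (List; length)
open import Data.List.Membership.Propositional using (_∈_)
open import Data.List.Relation.Unary.Unique.Propositional using (Unique)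
open import Data.Product using (Σ; ∃; _×_; _,_)
open import Relation.Binary.PropositionalEquality using (_≡_; _≢_)
open import Function.Bundles using (_⇔_; _↔_; Inverse)

record Graph (n : ℕ) : Set where
  field
    adj    : Fin n → Fin n → Bool
    sym    : ∀ i j → adj i j ≡ adj j i
    irrefl : ∀ i → adj i i ≡ false
open Graph public

data Walk {n : ℕ} (R : Fin n → Fin n → Set) : Fin n → Fin n → Set where
  here : ∀ {x} → Walk R x x
  step : ∀ {x y z} → R x y → Walk R y z → Walk R x z

Edge : ∀ {n} → Graph n → Fin n → Fin n → Set
Edge G x y = adj G x y ≡ true

-- G is connected (note: Fin n with n ≥ 3 is nonempty).
ConnectedGraph : ∀ {n} → Graph n → Set
ConnectedGraph {n} G = ∀ (x y : Fin n) → Walk (Edge G) x y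

EdgeAvoiding : ∀ {n} → Graph n → Fin n → Fin n → Fin n → Set
EdgeAvoiding G v x y = Edge G x y × x ≢ v × y ≢ v

IsCutVertex : ∀ {n} → Graph n → Fin n → Set
IsCutVertex {n} G v =
  Σ (Fin n) λ x → Σ (Fin n) λ y → x ≢ v × y ≢ v × (Walk (EdgeAvoiding G v) x y → Data.Empty.⊥)
  where import Data.Empty

NoCutVertex : ∀ {n} → Graph n → Set
NoCutVertex {n} G = ∀ (v : Fin n) → IsCutVertex G v → Data.Empty.⊥
  where import Data.Empty

-- Raw subgraph data: a vertex subset and an edge set as a symmetric 0/1 matrix.
SubData : ℕ → Set
SubData n = Vec Bool n × Vec (Vec Bool n) n

InV : ∀ {n} → SubData n → Fin n → Set
InV (S , E) x = lookup S x ≡ true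

InE : ∀ {n} → SubData n → Fin n → Fin n → Set
InE (S , E) x y = lookup (lookup E x) y ≡ true

-- (S , E) is a subgraph of G: E is a symmetric set of edges of G with both ends in S.
-- (Loops are excluded since G has none.)  Distinct pairs (S,E) = distinct subgraphs.
IsSubgraph : ∀ {n} → Graph n → SubData n → Set
IsSubgraph {n} G H =
  (∀ (x y : Fin n) → lookup (lookup (Data.Product.proj₂ H) x) y ≡ lookup (lookup (Data.Product.proj₂ H) y) x)
  × (∀ (x y : Fin n) → InE H x y → Edge G x y × InV H x × InV H y)
  where import Data.Product

ConnectedSub : ∀ {n} → SubData n → Set
ConnectedSub {n} H = (∃ λ (x : Fin n) → InV H x)
  × (∀ (x y : Fin n) → InV H x → InV H y → Walk (InE H) x y)

ConnSubContaining : ∀ {n} → Graph n → Fin n → SubData n → Set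
ConnSubContaining G v H = IsSubgraph G H × ConnectedSub H × InV H v

-- f_G(v) = k : there is a duplicate-free list of length k whose members are
-- exactly the connected subgraphs of G containing v.
fEquals : ∀ {n} → Graph n → Fin n → ℕ → Set
fEquals {n} G v k = Σ (List (SubData n)) λ xs →
  length xs ≡ k × Unique xs × (∀ (H : SubData n) → (H ∈ xs) ⇔ ConnSubContaining G v H)

-- Adjacency of the cycle C_n on 0,1,...,n-1 (meaningful for n ≥ 3).
cycAdj : (n : ℕ) → Fin n → Fin n → Bool
cycAdj n i j =
  (toℕ j ≡ᵇ suc (toℕ i)) ∨ (toℕ i ≡ᵇ suc (toℕ j))
  ∨ ((toℕ i ≡ᵇ 0) ∧ (toℕ j ≡ᵇ (n ∸ 1))) ∨ ((toℕ j ≡ᵇ 0) ∧ (toℕ i ≡ᵇ (n ∸ 1)))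

IsoCycle : ∀ {n} → Graph n → Set
IsoCycle {n} G = Σ (Fin n ↔ Fin n) λ σ →
  ∀ (i j : Fin n) → adj G i j ≡ cycAdj n (Inverse.to σ i) (Inverse.to σ j)

-- A 2-connected graph has an st-numbering v = x₀, x₁, …, x_{n-1} = t: vt is an edge, every
-- vertex but v has an earlier neighbour and every vertex but t a later one (it is built from an
-- ear decomposition started at vt). For a < b the vertices x₀…x_a and x_{b+1}…x_{n-1} span a
-- connected subgraph through v (walk down to v, or up to t and across tv); for a = b take G minus
-- the edge e_a from x_{a+1} to its chosen earlier neighbour, with e_{n-1} = vt. With G itself this
-- gives 1 + n(n+1)/2 distinct connected subgraphs through v. If there are no others, every edge
-- is some e_a (otherwise G minus that edge is another) and every x_{a+1} is adjacent to x_a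
-- (otherwise x₀…x_j plus x_{a+1}, for its earlier neighbour x_j, is another), so G is the cycle
-- x₀x₁…x_{n-1}. Conversely, on a cycle deleting two edges cuts off an arc, and this pins down every
-- connected subgraph through v as a member of the family.

module Submission where

open import Defs hiding (sym)
open import Level using (0ℓ)
open import Data.Nat using (ℕ; zero; suc; _+_; _*_; _∸_; _≤_; _<_; z≤n; s≤s; z<s; _≤?_; _<?_)
open import Data.Nat.Properties
open import Data.Nat.Induction using (<-wellFounded)
open import Data.Nat.Tactic.RingSolver using (solve-∀)
open import Induction.WellFounded using (Acc; acc)
open import Data.Bool using (Bool; true; false; _∨_; not; if_then_else_)
open import Data.Bool.Properties using (¬-not) renaming (_≟_ to _≟ᵇ_)
open import Data.Fin using (Fin; toℕ; fromℕ<; punchOut; splitAt; _↑ˡ_; _↑ʳ_) renaming (zero to fzero; suc to fsuc)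
open import Data.Fin.Properties
  using (any?; injective⇒≤; punchOut-injective; toℕ<n; toℕ-fromℕ<; toℕ-injective; splitAt-↑ˡ; splitAt-↑ʳ; splitAt⁻¹-↑ˡ; splitAt⁻¹-↑ʳ)
  renaming (_≟_ to _≟ᶠ_)
open import Data.Vec using (lookup; tabulate)
open import Data.Vec.Properties using (lookup∘tabulate; tabulate∘lookup; tabulate-cong)
open import Data.List using (List; []; _∷_; length)
import Data.List as List
open import Data.List.Membership.Propositional using (_∈_)
open import Data.List.Membership.Propositional.Properties using (∈-lookup)
open import Data.List.Relation.Unary.Any using (here; there; index)
open import Data.List.Relation.Unary.Any.Properties using (lookup-index)
open import Data.List.Relation.Unary.All using (All; []; _∷_)
import Data.List.Relation.Unary.All as All
open import Data.List.Relation.Unary.AllPairs using ([]; _∷_)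
open import Data.List.Relation.Unary.Unique.Propositional using (Unique)
open import Data.Product using (Σ; ∃; ∃₂; _×_; _,_; proj₁; proj₂; uncurry)
open import Data.Sum using (_⊎_; inj₁; inj₂)
import Data.Sum as Sum
open import Data.Unit using (⊤; tt)
open import Data.Empty using (⊥; ⊥-elim)
open import Relation.Nullary using (¬_; Dec; yes; no; does; contradiction; ¬?)
open import Relation.Nullary.Decidable using (dec-true; dec-false; does-⇔; _×-dec_; _⊎-dec_)
import Relation.Unary as U
open import Relation.Binary using (Rel; Decidable; tri<; tri≈; tri>)
open import Relation.Binary.PropositionalEquality
  using (_≡_; _≢_; refl; sym; trans; cong; cong₂; subst; subst₂; module ≡-Reasoning)
open import Function using (_∘_)
open import Function.Definitions using (Injective)
open import Function.Bundles using (_⇔_; mk⇔; Equivalence; Inverse; _↔_; mk↔ₛ′)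

private variable
  A : Set
  n m : ℕ
  R R′ : Rel (Fin n) 0ℓ
  x y z : Fin n

does-true : (a? : Dec A) → does a? ≡ true → A
does-true (yes a) _ = a

true≢false : true ≢ false
true≢false ()

∨-introˡ : ∀ {a} b → a ≡ true → a ∨ b ≡ true
∨-introˡ b refl = refl

∨-introʳ : ∀ a {b} → b ≡ true → a ∨ b ≡ true
∨-introʳ true _ = refl
∨-introʳ false b≡true = b≡true

∨-elim : ∀ a {b} → a ∨ b ≡ true → a ≡ true ⊎ b ≡ true
∨-elim true _ = inj₁ refl
∨-elim false b≡true = inj₂ b≡true

if-true : ∀ {A : Set} {b : Bool} {x y : A} → b ≡ true → (if b then x else y) ≡ x
if-true refl = refl

if-false : ∀ {A : Set} {b : Bool} {x y : A} → b ≡ false → (if b then x else y) ≡ y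
if-false refl = refl

does-≟true : ∀ b → does (b ≟ᵇ true) ≡ b
does-≟true true = refl
does-≟true false = refl

walk-map : (∀ {a b} → R a b → R′ a b) → Walk R x y → Walk R′ x y
walk-map f here = here
walk-map f (step r w) = step (f r) (walk-map f w)

infixr 5 _◅◅_

_◅◅_ : Walk R x y → Walk R y z → Walk R x z
here ◅◅ w = w
step r w ◅◅ w′ = step r (w ◅◅ w′)

walk-reverse : (∀ {a b} → R a b → R b a) → Walk R x y → Walk R y x
walk-reverse R-sym here = here
walk-reverse R-sym (step r w) = walk-reverse R-sym w ◅◅ step (R-sym r) here

walk-preserves : (Q : Fin n → Set) → (∀ {a b} → R a b → Q a → Q b) → Walk R x y → Q x → Q y
walk-preserves Q pres here qx = qx
walk-preserves Q pres (step r w) qx = walk-preserves Q pres w (pres r qx)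

walk-first-step : Walk R x y → x ≢ y → ∃ (R x)
walk-first-step here x≢x = contradiction refl x≢x
walk-first-step (step r _) _ = _ , r

walk-exits : (U : Fin n → Bool) → Walk R x y → U x ≡ true → U y ≡ false →
             ∃₂ λ a b → U a ≡ true × U b ≡ false × R a b
walk-exits U here Ux Uy = contradiction (trans (sym Ux) Uy) true≢false
walk-exits U (step {y = b} r w) Ux Uy with U b in Ub
... | true = walk-exits U w Ub Uy
... | false = _ , b , Ux , Ub , r

walk-by-descent : (μ : Fin n → ℕ) (Q : Fin n → Set) (s : Fin n) →
                  (∀ a → Q a → a ≢ s → ∃ λ b → R a b × Q b × μ b < μ a) →
                  ∀ a → Q a → Walk R a s
walk-by-descent {R = R} μ Q s descend a Qa = go a Qa (<-wellFounded (μ a))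
  where
  go : ∀ a → Q a → Acc _<_ (μ a) → Walk R a s
  go a Qa (acc rec) with a ≟ᶠ s
  ... | yes refl = here
  ... | no a≢s with descend a Qa a≢s
  ...   | b , r , Qb , μb<μa = step r (go b Qb (rec μb<μa))

count : (Fin n → Bool) → ℕ
count {zero} f = 0
count {suc n} f = (if f fzero then 1 else 0) + count (f ∘ fsuc)

count≤n : (f : Fin n → Bool) → count f ≤ n
count≤n {zero} f = z≤n
count≤n {suc n} f with f fzero
... | true = s≤s (count≤n (f ∘ fsuc))
... | false = m≤n⇒m≤1+n (count≤n (f ∘ fsuc))

count-none : (f : Fin n → Bool) → (∀ x → f x ≡ false) → count f ≡ 0
count-none {zero} f none = refl
count-none {suc n} f none rewrite none fzero = count-none (f ∘ fsuc) (none ∘ fsuc)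

count-mono : (f g : Fin n → Bool) → (∀ x → f x ≡ true → g x ≡ true) → count f ≤ count g
count-mono {zero} f g f⊆g = z≤n
count-mono {suc n} f g f⊆g with f fzero in f0 | g fzero in g0
... | true | true = s≤s (count-mono (f ∘ fsuc) (g ∘ fsuc) (f⊆g ∘ fsuc))
... | true | false = contradiction (trans (sym (f⊆g fzero f0)) g0) true≢false
... | false | true = m≤n⇒m≤1+n (count-mono (f ∘ fsuc) (g ∘ fsuc) (f⊆g ∘ fsuc))
... | false | false = count-mono (f ∘ fsuc) (g ∘ fsuc) (f⊆g ∘ fsuc)

count-strict : (f g : Fin n → Bool) → (∀ x → f x ≡ true → g x ≡ true) →
               ∀ x → f x ≡ false → g x ≡ true → count f < count g
count-strict f g f⊆g fzero fx gx rewrite fx | gx = s≤s (count-mono (f ∘ fsuc) (g ∘ fsuc) (f⊆g ∘ fsuc))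
count-strict f g f⊆g (fsuc x) fx gx with f fzero in f0 | g fzero in g0
... | true | true = s≤s (count-strict (f ∘ fsuc) (g ∘ fsuc) (f⊆g ∘ fsuc) x fx gx)
... | true | false = contradiction (trans (sym (f⊆g fzero f0)) g0) true≢false
... | false | true = m≤n⇒m≤1+n (count-strict (f ∘ fsuc) (g ∘ fsuc) (f⊆g ∘ fsuc) x fx gx)
... | false | false = count-strict (f ∘ fsuc) (g ∘ fsuc) (f⊆g ∘ fsuc) x fx gx

count<n : (f : Fin n → Bool) → ∀ x → f x ≡ false → count f < n
count<n f x fx = ≤-trans (count-strict f (λ _ → true) (λ _ _ → refl) x fx refl) (count≤n (λ _ → true))

module _ {R : Rel (Fin n) 0ℓ} (R? : Decidable R) (source : Fin n) where
  -- reached k holds the vertices within k steps of the source; these sets stop growing within n rounds.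
  private
    reached : ℕ → Fin n → Bool
    extends? : ∀ k y → Dec (∃ λ z → reached k z ≡ true × R z y)
    reached zero y = does (source ≟ᶠ y)
    reached (suc k) y = reached k y ∨ does (extends? k y)
    extends? k y = any? λ z → (reached k z ≟ᵇ true) ×-dec R? z y

    reached⇒walk : ∀ k y → reached k y ≡ true → Walk R source y
    reached⇒walk zero y r with does-true (source ≟ᶠ y) r
    ... | refl = here
    reached⇒walk (suc k) y r with ∨-elim (reached k y) r
    ... | inj₁ r′ = reached⇒walk k y r′
    ... | inj₂ e with does-true (extends? k y) e
    ...   | z , rz , Rzy = reached⇒walk k z rz ◅◅ step Rzy here

    source-reached : ∀ k → reached k source ≡ true
    source-reached zero = dec-true (source ≟ᶠ source) refl
    source-reached (suc k) = ∨-introˡ _ (source-reached k)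

    Closed : ℕ → Set
    Closed k = ∀ y → reached (suc k) y ≡ true → reached k y ≡ true

    closes-or-grows : ∀ k → ∃ Closed ⊎ k < count (reached k)
    closes-or-grows zero = inj₂ (subst (_< count (reached 0)) (count-none {n} _ λ _ → refl)
      (count-strict (λ _ → false) (reached 0) (λ _ ()) source refl (source-reached 0)))
    closes-or-grows (suc k) with closes-or-grows k
    ... | inj₁ closed = inj₁ closed
    ... | inj₂ k<count with any? (λ y → (reached (suc k) y ≟ᵇ true) ×-dec (reached k y ≟ᵇ false))
    ...   | yes (y , new , old) = inj₂ (≤-trans (s≤s k<count)
              (count-strict (reached k) (reached (suc k)) (λ z r → ∨-introˡ _ r) y old new))
    ...   | no none = inj₁ (k , λ y r → ¬-not λ r′ → none (y , r , r′))

    closed : ∃ Closed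
    closed with closes-or-grows n
    ... | inj₁ c = c
    ... | inj₂ n<count = contradiction (count≤n (reached n)) (<⇒≱ n<count)

    walk⇒reached : ∀ y → Walk R source y → reached (proj₁ closed) y ≡ true
    walk⇒reached y w = walk-preserves (λ z → reached k z ≡ true) extend w (source-reached k)
      where
      k = proj₁ closed
      extend : ∀ {a b} → R a b → reached k a ≡ true → reached k b ≡ true
      extend {a} {b} r ra = proj₂ closed b (∨-introʳ _ (dec-true (extends? k b) (a , ra , r)))

  walk? : ∀ y → Dec (Walk R source y)
  walk? y with reached (proj₁ closed) y in r
  ... | true = yes (reached⇒walk (proj₁ closed) y r)
  ... | false = no λ w → contradiction (trans (sym (walk⇒reached y w)) r) true≢false

module _ (f : Fin n → ℕ) where

  rankBy : Fin n → ℕ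
  rankBy x = count (λ y → does (f y <? f x))

  rankBy<n : ∀ x → rankBy x < n
  rankBy<n x = count<n _ x (dec-false (f x <? f x) (<-irrefl refl))

  rankBy-mono : f x < f y → rankBy x < rankBy y
  rankBy-mono {x} {y} fx<fy = count-strict _ _
    (λ z fz<fx → dec-true (f z <? f y) (<-trans (does-true (f z <? f x) fz<fx) fx<fy))
    x (dec-false (f x <? f x) (<-irrefl refl)) (dec-true (f x <? f y) fx<fy)

  rankBy-minimum : (∀ y → ¬ f y < f x) → rankBy x ≡ 0
  rankBy-minimum {x} minimum = count-none _ λ y → dec-false (f y <? f x) (minimum y)

injective⇒surjective : (f : Fin n → Fin n) → Injective _≡_ _≡_ f → ∀ y → ∃ λ x → f x ≡ y
injective⇒surjective {zero} f f-inj ()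
injective⇒surjective {suc n} f f-inj y with any? (λ x → f x ≟ᶠ y)
... | yes hit = hit
... | no miss = contradiction (injective⇒≤ g-inj) (<-irrefl refl)
  where
  f≢y : ∀ x → y ≢ f x
  f≢y x y≡fx = miss (x , sym y≡fx)
  g : Fin (suc n) → Fin n
  g x = punchOut (f≢y x)
  g-inj : Injective _≡_ _≡_ g
  g-inj eq = f-inj (punchOut-injective (f≢y _) (f≢y _) eq)

injective⇒↔ : (f : Fin n → Fin n) → Injective _≡_ _≡_ f → Fin n ↔ Fin n
injective⇒↔ {n = n} f f-inj = mk↔ₛ′ f f⁻¹ (proj₂ ∘ surj) (λ x → f-inj (proj₂ (surj (f x))))
  where
  surj : ∀ y → ∃ λ x → f x ≡ y
  surj = injective⇒surjective f f-inj
  f⁻¹ : Fin n → Fin n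
  f⁻¹ = proj₁ ∘ surj

injective-below⇒surjective : (f : Fin n → ℕ) → (∀ x → f x < n) → (∀ {x y} → f x ≡ f y → x ≡ y) →
                             ∀ {p} → p < n → ∃ λ x → f x ≡ p
injective-below⇒surjective f f<n f-inj p<n =
  let x , x↦p = injective⇒surjective (λ x → fromℕ< (f<n x)) fin-inj (fromℕ< p<n)
  in x , trans (sym (toℕ-fromℕ< _)) (trans (cong toℕ x↦p) (toℕ-fromℕ< p<n))
  where
  fin-inj : Injective _≡_ _≡_ (λ x → fromℕ< (f<n x))
  fin-inj eq = f-inj (trans (sym (toℕ-fromℕ< _)) (trans (cong toℕ eq) (toℕ-fromℕ< _)))

lookup-injective : {xs : List A} → Unique xs → Injective _≡_ _≡_ (List.lookup xs)
lookup-injective {xs = _ ∷ _} (_ ∷ _) {fzero} {fzero} _ = refl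
lookup-injective {xs = _ ∷ _} (x∉xs ∷ _) {fzero} {fsuc j} eq = ⊥-elim (All.lookup x∉xs (∈-lookup j) eq)
lookup-injective {xs = _ ∷ _} (x∉xs ∷ _) {fsuc i} {fzero} eq = ⊥-elim (All.lookup x∉xs (∈-lookup i) (sym eq))
lookup-injective {xs = _ ∷ _} (_ ∷ xs!) {fsuc i} {fsuc j} eq = cong fsuc (lookup-injective xs! eq)

injection-into-list⇒≤ : (xs : List A) (φ : Fin m → A) → Injective _≡_ _≡_ φ → (∀ i → φ i ∈ xs) → m ≤ length xs
injection-into-list⇒≤ xs φ φ-inj φ∈xs = injective⇒≤ {f = index ∘ φ∈xs} λ {i} {j} eq →
  φ-inj (trans (lookup-index (φ∈xs i)) (trans (cong (List.lookup xs) eq) (sym (lookup-index (φ∈xs j)))))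

covered-unique-list⇒≤ : (xs : List A) (φ : Fin m → A) → Unique xs → (∀ x → x ∈ xs → ∃ λ i → φ i ≡ x) →
                        length xs ≤ m
covered-unique-list⇒≤ {m = m} xs φ xs! covered = injective⇒≤ {f = preimage} λ {i} {j} eq →
  lookup-injective xs! (trans (sym (preimage-≡ i)) (trans (cong φ eq) (preimage-≡ j)))
  where
  preimage : Fin (length xs) → Fin m
  preimage i = proj₁ (covered _ (∈-lookup i))
  preimage-≡ : ∀ i → φ (preimage i) ≡ List.lookup xs i
  preimage-≡ i = proj₂ (covered _ (∈-lookup i))

suc[m∸1]≡m : 0 < m → suc (m ∸ 1) ≡ m
suc[m∸1]≡m {suc m} _ = refl

module _ {Q : ℕ → Set} (Q? : U.Decidable Q) where

  minimal : ∀ {k} → Q k → ∃ λ m → Q m × (∀ {p} → Q p → m ≤ p)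
  minimal {k} Qk = go k Qk (<-wellFounded k)
    where
    go : ∀ k → Q k → Acc _<_ k → ∃ λ m → Q m × (∀ {p} → Q p → m ≤ p)
    go k Qk (acc rec) with anyUpTo? Q? k
    ... | yes (p , p<k , Qp) = go p Qp (rec p<k)
    ... | no none = k , Qk , λ {p} Qp → ≮⇒≥ λ p<k → none (p , p<k , Qp)

  maximal : ∀ {b k} → Q k → (∀ {p} → Q p → p < b) → ∃ λ M → Q M × (∀ {p} → Q p → p ≤ M)
  maximal {b} {k} Qk bounded = go k Qk (<-wellFounded (b ∸ k))
    where
    go : ∀ k → Q k → Acc _<_ (b ∸ k) → ∃ λ M → Q M × (∀ {p} → Q p → p ≤ M)
    go k Qk (acc rec) with anyUpTo? (λ p → k <? p ×-dec Q? p) b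
    ... | yes (p , _ , k<p , Qp) = go p Qp (rec (∸-monoʳ-< k<p (<⇒≤ (bounded Qp))))
    ... | no none = k , Qk , λ {p} Qp → ≮⇒≥ λ k<p → none (p , bounded Qp , k<p , Qp)

triangle : ℕ → ℕ
triangle zero = 0
triangle (suc m) = suc m + triangle m

twice-triangle : ∀ m → 2 * triangle m ≡ m * m + m
twice-triangle zero = refl
twice-triangle (suc m) = begin
  2 * (suc m + triangle m)    ≡⟨ *-distribˡ-+ 2 (suc m) (triangle m) ⟩
  2 * suc m + 2 * triangle m  ≡⟨ cong (2 * suc m +_) (twice-triangle m) ⟩
  2 * suc m + (m * m + m)     ≡⟨ square-step m ⟩
  suc m * suc m + suc m       ∎
  where
  open ≡-Reasoning
  square-step : ∀ m → 2 * suc m + (m * m + m) ≡ suc m * suc m + suc m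
  square-step = solve-∀

twice-suc-triangle : ∀ m → 2 * suc (triangle m) ≡ m * m + m + 2
twice-suc-triangle m = trans (*-suc 2 (triangle m)) (trans (cong (2 +_) (twice-triangle m)) (+-comm 2 (m * m + m)))

pair : ∀ m → Fin (triangle m) → ℕ × ℕ
pair (suc m) i with splitAt (suc m) i
... | inj₁ a = toℕ a , m
... | inj₂ j = pair m j

pair-ordered : ∀ m i → proj₁ (pair m i) ≤ proj₂ (pair m i) × proj₂ (pair m i) < m
pair-ordered (suc m) i with splitAt (suc m) i
... | inj₁ a = ≤-pred (toℕ<n a) , ≤-refl
... | inj₂ j = proj₁ (pair-ordered m j) , m≤n⇒m≤1+n (proj₂ (pair-ordered m j))

pair-injective : ∀ m {i j} → pair m i ≡ pair m j → i ≡ j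
pair-injective (suc m) {i} {j} eq with splitAt (suc m) i in split-i | splitAt (suc m) j in split-j
... | inj₁ a | inj₁ b = trans (sym (splitAt⁻¹-↑ˡ split-i))
      (trans (cong (_↑ˡ triangle m) (toℕ-injective (cong proj₁ eq))) (splitAt⁻¹-↑ˡ split-j))
... | inj₁ a | inj₂ b = contradiction (sym (cong proj₂ eq)) (<⇒≢ (proj₂ (pair-ordered m b)))
... | inj₂ a | inj₁ b = contradiction (cong proj₂ eq) (<⇒≢ (proj₂ (pair-ordered m a)))
... | inj₂ a | inj₂ b = trans (sym (splitAt⁻¹-↑ʳ split-i))
      (trans (cong (suc m ↑ʳ_) (pair-injective m eq)) (splitAt⁻¹-↑ʳ split-j))

pair-surjective : ∀ m {a b} → a ≤ b → b < m → ∃ λ i → pair m i ≡ (a , b)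
pair-surjective (suc m) {a} {b} a≤b b<1+m with b ≟ m
... | yes refl = fromℕ< (s≤s a≤b) ↑ˡ triangle m , pair-left
  where
  pair-left : pair (suc m) (fromℕ< (s≤s a≤b) ↑ˡ triangle m) ≡ (a , b)
  pair-left rewrite splitAt-↑ˡ (suc m) (fromℕ< (s≤s a≤b)) (triangle m) = cong (_, b) (toℕ-fromℕ< _)
... | no b≢m with pair-surjective m a≤b (≤∧≢⇒< (≤-pred b<1+m) b≢m)
...   | j , pair-j = suc m ↑ʳ j , pair-right
  where
  pair-right : pair (suc m) (suc m ↑ʳ j) ≡ (a , b)
  pair-right rewrite splitAt-↑ʳ (suc m) (triangle m) j = pair-j

another-vertex : 2 ≤ n → (v : Fin n) → ∃ (_≢ v)
another-vertex (s≤s (s≤s _)) fzero = fsuc fzero , λ ()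
another-vertex (s≤s (s≤s _)) (fsuc v) = fzero , λ ()

edge-sym : (G : Graph n) → Edge G x y → Edge G y x
edge-sym {x = x} {y = y} G e = trans (Graph.sym G y x) e

edge-irrefl : (G : Graph n) → Edge G x y → x ≢ y
edge-irrefl {x = x} G e refl = true≢false (trans (sym e) (Graph.irrefl G x))

-- Opaque, so that the predicates can be recovered from subgraph V? E? by unification.
opaque
  subgraph : {V : Fin n → Set} {E : Rel (Fin n) 0ℓ} → ((x : Fin n) → Dec (V x)) → Decidable E → SubData n
  subgraph V? E? = tabulate (does ∘ V?) , tabulate (λ x → tabulate (does ∘ E? x))

lookup²∘tabulate² : ∀ {A : Set} (f : Fin n → Fin n → A) x y → lookup (lookup (tabulate (tabulate ∘ f)) x) y ≡ f x y
lookup²∘tabulate² f x y = trans (cong (λ row → lookup row y) (lookup∘tabulate _ x)) (lookup∘tabulate _ y)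

module _ {V : Fin n → Set} {E : Rel (Fin n) 0ℓ} {V? : ∀ x → Dec (V x)} {E? : Decidable E} where
  opaque
    unfolding subgraph


    InV-subgraph⁺ : V x → InV (subgraph V? E?) x
    InV-subgraph⁺ {x = x} Vx = trans (lookup∘tabulate _ x) (dec-true (V? x) Vx)

    InV-subgraph⁻ : InV (subgraph V? E?) x → V x
    InV-subgraph⁻ {x = x} x∈H = does-true (V? x) (trans (sym (lookup∘tabulate _ x)) x∈H)

    InE-subgraph⁺ : E x y → InE (subgraph V? E?) x y
    InE-subgraph⁺ {x = x} {y = y} Exy = trans (lookup²∘tabulate² _ x y) (dec-true (E? x y) Exy)

    InE-subgraph⁻ : InE (subgraph V? E?) x y → E x y
    InE-subgraph⁻ {x = x} {y = y} xy∈H = does-true (E? x y) (trans (sym (lookup²∘tabulate² _ x y)) xy∈H)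

    subgraph-symmetric : (∀ {x y} → E x y → E y x) → ∀ x y →
      lookup (lookup (proj₂ (subgraph V? E?)) x) y ≡ lookup (lookup (proj₂ (subgraph V? E?)) y) x
    subgraph-symmetric E-sym x y = trans (lookup²∘tabulate² _ x y)
      (trans (does-⇔ (mk⇔ E-sym E-sym) (E? x y) (E? y x)) (sym (lookup²∘tabulate² _ y x)))

    subgraph-≗ : (H : SubData n) → (∀ x → V x ⇔ InV H x) → (∀ x y → E x y ⇔ InE H x y) → subgraph V? E? ≡ H
    subgraph-≗ (S , M) V⇔ E⇔ = cong₂ _,_
      (trans (tabulate-cong λ x → same (V? x) (V⇔ x)) (tabulate∘lookup S))
      (trans (tabulate-cong λ x → trans (tabulate-cong λ y → same (E? x y) (E⇔ x y)) (tabulate∘lookup (lookup M x)))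
             (tabulate∘lookup M))
      where
      same : ∀ {A : Set} {b} (a? : Dec A) → A ⇔ (b ≡ true) → does a? ≡ b
      same {b = b} a? A⇔b = trans (does-⇔ A⇔b a? (b ≟ᵇ true)) (does-≟true b)

module _ {V V′ : Fin n → Set} {E E′ : Rel (Fin n) 0ℓ} {V? : ∀ x → Dec (V x)} {E? : Decidable E}
         {V′? : ∀ x → Dec (V′ x)} {E′? : Decidable E′} (eq : subgraph V? E? ≡ subgraph V′? E′?) where

  subgraph-≡⇒V : V x → V′ x
  subgraph-≡⇒V {x = x} Vx = InV-subgraph⁻ (subst (λ H → InV H x) eq (InV-subgraph⁺ Vx))

  subgraph-≡⇒E : E x y → E′ x y
  subgraph-≡⇒E {x = x} {y = y} Exy = InE-subgraph⁻ (subst (λ H → InE H x y) eq (InE-subgraph⁺ Exy))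

subgraph-connected : {V : Fin n → Set} {E : Rel (Fin n) 0ℓ} {v : Fin n} (V? : ∀ x → Dec (V x)) (E? : Decidable E) →
                     (G : Graph n) →
                     (∀ {x y} → E x y → E y x) → (∀ {x y} → E x y → Edge G x y × V x × V y) →
                     V v → (∀ x → V x → Walk E x v) → ConnSubContaining G v (subgraph V? E?)
subgraph-connected {n = n} {V = V} {E = E} {v = v} V? E? G E-sym E⊆G Vv to-v =
  (subgraph-symmetric E-sym , E-in-G) , ((v , InV-subgraph⁺ Vv) , connected) , InV-subgraph⁺ Vv
  where
  H : SubData n
  H = subgraph V? E?
  E-in-G : ∀ x y → InE H x y → Edge G x y × InV H x × InV H y
  E-in-G x y xy∈H with E⊆G (InE-subgraph⁻ xy∈H)
  ... | e , Vx , Vy = e , InV-subgraph⁺ Vx , InV-subgraph⁺ Vy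
  connected : ∀ x y → InV H x → InV H y → Walk (InE H) x y
  connected x y x∈H y∈H = walk-map InE-subgraph⁺
    (to-v x (InV-subgraph⁻ x∈H) ◅◅ walk-reverse E-sym (to-v y (InV-subgraph⁻ y∈H)))

CycleAdjacent : ℕ → ℕ → ℕ → Set
CycleAdjacent n p q = q ≡ suc p ⊎ p ≡ suc q ⊎ (p ≡ 0 × q ≡ n ∸ 1) ⊎ (q ≡ 0 × p ≡ n ∸ 1)

-- cycAdj n i j from Defs is definitionally does (cycleAdjacent? n (toℕ i) (toℕ j)).
cycleAdjacent? : ∀ n p q → Dec (CycleAdjacent n p q)
cycleAdjacent? n p q = q ≟ suc p ⊎-dec p ≟ suc q ⊎-dec (p ≟ 0 ×-dec q ≟ n ∸ 1) ⊎-dec (q ≟ 0 ×-dec p ≟ n ∸ 1)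

adjacent-sym : ∀ {n p q} → CycleAdjacent n p q → CycleAdjacent n q p
adjacent-sym (inj₁ e) = inj₂ (inj₁ e)
adjacent-sym (inj₂ (inj₁ e)) = inj₁ e
adjacent-sym (inj₂ (inj₂ (inj₁ e))) = inj₂ (inj₂ (inj₂ e))
adjacent-sym (inj₂ (inj₂ (inj₂ e))) = inj₂ (inj₂ (inj₁ e))

next : ℕ → ℕ → ℕ
next n p with suc p <? n
... | yes _ = suc p
... | no _ = 0

next<n : ∀ {p} → 0 < n → next n p < n
next<n {n} {p} 0<n with suc p <? n
... | yes 1+p<n = 1+p<n
... | no _ = 0<n

next-injective : ∀ {p q} → p < n → q < n → next n p ≡ next n q → p ≡ q
next-injective {n} {p} {q} p<n q<n eq with suc p <? n | suc q <? n
... | yes _ | yes _ = suc-injective eq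
... | yes _ | no _ = contradiction eq 1+n≢0
... | no _ | yes _ = contradiction (sym eq) 1+n≢0
... | no p≮ | no q≮ = suc-injective (trans (≤-antisym p<n (≮⇒≥ p≮)) (sym (≤-antisym q<n (≮⇒≥ q≮))))

next-cases : ∀ p → (suc p < n × next n p ≡ suc p) ⊎ (¬ suc p < n × next n p ≡ 0)
next-cases {n} p with suc p <? n
... | yes 1+p<n = inj₁ (1+p<n , refl)
... | no 1+p≮n = inj₂ (1+p≮n , refl)

next-top : ∀ {p} → suc p ≡ n → next n p ≡ 0
next-top {n} {p} 1+p≡n with suc p <? n
... | yes 1+p<n = contradiction 1+p≡n (<⇒≢ 1+p<n)
... | no _ = refl

next-below : ∀ {p} → suc p < n → next n p ≡ suc p
next-below {n} {p} 1+p<n with suc p <? n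
... | yes _ = refl
... | no 1+p≮n = contradiction 1+p<n 1+p≮n

successor⇒adjacent : ∀ {p q} → p < n → q ≡ next n p → CycleAdjacent n p q
successor⇒adjacent {n} {p} p<n q≡next with suc p <? n
... | yes _ = inj₁ q≡next
... | no 1+p≮n = inj₂ (inj₂ (inj₂ (q≡next , cong (_∸ 1) (≤-antisym p<n (≮⇒≥ 1+p≮n)))))

adjacent⇔successor : ∀ {p q} → p < n → q < n → CycleAdjacent n p q ⇔ (q ≡ next n p ⊎ p ≡ next n q)
adjacent⇔successor {n} {p} {q} p<n q<n = mk⇔ to from
  where
  top : ∀ {r} → r < n → r ≡ n ∸ 1 → suc r ≡ n
  top r<n refl = m+[n∸m]≡n {1} (≤-trans (s≤s z≤n) r<n)
  to : CycleAdjacent n p q → q ≡ next n p ⊎ p ≡ next n q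
  to (inj₁ refl) = inj₁ (sym (next-below q<n))
  to (inj₂ (inj₁ refl)) = inj₂ (sym (next-below p<n))
  to (inj₂ (inj₂ (inj₁ (refl , q≡top)))) = inj₂ (sym (next-top (top q<n q≡top)))
  to (inj₂ (inj₂ (inj₂ (refl , p≡top)))) = inj₁ (sym (next-top (top p<n p≡top)))
  from : q ≡ next n p ⊎ p ≡ next n q → CycleAdjacent n p q
  from (inj₁ q≡next) = successor⇒adjacent p<n q≡next
  from (inj₂ p≡next) = adjacent-sym {n} (successor⇒adjacent q<n p≡next)

adjacent-next : ∀ {p q} → p < n → q < n → CycleAdjacent n p q → CycleAdjacent n (next n p) (next n q)
adjacent-next {n} p<n q<n adjacent =
  Equivalence.from (adjacent⇔successor (next<n 0<n) (next<n 0<n))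
    (Sum.map (cong (next n)) (cong (next n)) (Equivalence.to (adjacent⇔successor p<n q<n) adjacent))
  where
  0<n : 0 < n
  0<n = ≤-<-trans z≤n p<n

adjacent-next⁻ : ∀ {p q} → p < n → q < n → CycleAdjacent n (next n p) (next n q) → CycleAdjacent n p q
adjacent-next⁻ {n} p<n q<n adjacent =
  Equivalence.from (adjacent⇔successor p<n q<n)
    (Sum.map (next-injective q<n (next<n 0<n)) (next-injective p<n (next<n 0<n))
             (Equivalence.to (adjacent⇔successor (next<n 0<n) (next<n 0<n)) adjacent))
  where
  0<n : 0 < n
  0<n = ≤-<-trans z≤n p<n

-- st-numberings

record STNumbering {n : ℕ} (G : Graph n) (s : Fin n) : Set where
  field
    pos : Fin n → ℕ
    pos<n : ∀ x → pos x < n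
    pos-injective : ∀ {x y} → pos x ≡ pos y → x ≡ y
    pos-source : pos s ≡ 0
    sink : Fin n
    pos-sink : suc (pos sink) ≡ n
    source-sink : Edge G s sink
    down up : Fin n → Fin n
    down-edge : ∀ x → 0 < pos x → Edge G x (down x)
    down-lower : ∀ x → 0 < pos x → pos (down x) < pos x
    -- needed when f is extremal: no member of the family detects a gap below the sink
    down-sink : suc (pos (down sink)) ≡ pos sink
    up-edge : ∀ x → suc (pos x) < n → Edge G x (up x)
    up-higher : ∀ x → suc (pos x) < n → pos x < pos (up x)

  at : ∀ {p} → p < n → Fin n
  at p<n = proj₁ (injective-below⇒surjective pos pos<n pos-injective p<n)

  pos-at : ∀ {p} (p<n : p < n) → pos (at p<n) ≡ p
  pos-at p<n = proj₂ (injective-below⇒surjective pos pos<n pos-injective p<n)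

  pos≤pos-sink : ∀ x → pos x ≤ pos sink
  pos≤pos-sink x = ≤-pred (subst (pos x <_) (sym pos-sink) (pos<n x))

  pos≡0⇒source : ∀ {x} → pos x ≡ 0 → x ≡ s
  pos≡0⇒source eq = pos-injective (trans eq (sym pos-source))

  ≢source⇒positive : ∀ {x} → x ≢ s → 0 < pos x
  ≢source⇒positive x≢s = n≢0⇒n>0 (x≢s ∘ pos≡0⇒source)

  below-sink : ∀ {x} → x ≢ sink → suc (pos x) < n
  below-sink {x} x≢sink = subst (suc (pos x) <_) pos-sink
    (s≤s (≤∧≢⇒< (pos≤pos-sink x) (x≢sink ∘ pos-injective)))

  walk-down : {R : Rel (Fin n) 0ℓ} (Q : Fin n → Set) →
              (∀ x → Q x → 0 < pos x → R x (down x) × Q (down x)) → ∀ x → Q x → Walk R x s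
  walk-down Q descend = walk-by-descent pos Q s λ x Qx x≢s →
    let 0<x = ≢source⇒positive x≢s in down x , proj₁ (descend x Qx 0<x) , proj₂ (descend x Qx 0<x) , down-lower x 0<x

  walk-up : {R : Rel (Fin n) 0ℓ} (Q : Fin n → Set) →
            (∀ x → Q x → suc (pos x) < n → R x (up x) × Q (up x)) → ∀ x → Q x → Walk R x sink
  walk-up Q climb = walk-by-descent (λ x → n ∸ pos x) Q sink λ x Qx x≢sink →
    let x<top = below-sink x≢sink in up x , proj₁ (climb x Qx x<top) , proj₂ (climb x Qx x<top) ,
      ∸-monoʳ-< (up-higher x x<top) (<⇒≤ (pos<n (up x)))

  down-sink≢source : 3 ≤ n → down sink ≢ s
  down-sink≢source 3≤n down-sink≡s = contradiction (subst (3 ≤_) n≡2 3≤n) λ { (s≤s (s≤s ())) }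
    where
    n≡2 : n ≡ 2
    n≡2 = trans (sym pos-sink) (cong suc (trans (sym down-sink) (cong suc (trans (cong pos down-sink≡s) pos-source))))

-- Ear decompositions

Ordered : Bool → ℕ → ℕ → Set
Ordered true a b = a < b
Ordered false a b = b < a

ordered-split : ∀ ascending {x y z} → Ordered ascending x y → Ordered ascending y z →
                (x < y × y < z) ⊎ (z < y × y < x)
ordered-split true x<y y<z = inj₁ (x<y , y<z)
ordered-split false y<x z<y = inj₂ (z<y , y<x)

-- Positions for the k inner vertices of an ear from u to z once all old positions are multiplied
-- by k + 1: slot 1, …, slot k run monotonically from (k+1)·pu to (k+1)·pz, avoid the multiples of
-- k + 1, and stay strictly between the scaled positions ps of the source and pt of the sink.
record EarSlots (k pu pz ps pt : ℕ) : Set where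
  field
    ascending : Bool
    slot : ℕ → ℕ
    slot-injective : ∀ {i j} → i < k → j < k → slot (suc i) ≡ slot (suc j) → i ≡ j
    slot-fresh : ∀ a {i} → i < k → suc k * a ≢ slot (suc i)
    source<slot : ∀ {i} → i < k → suc k * ps < slot (suc i)
    slot<sink : ∀ {i} → i < k → slot (suc i) < suc k * pt
    ordered-first : Ordered ascending (suc k * pu) (slot 1)
    ordered-next : ∀ {i} → suc i < k → Ordered ascending (slot (suc i)) (slot (suc (suc i)))
    ordered-last : Ordered ascending (slot k) (suc k * pz)

[1+k]*a+j<[1+k]*[1+a] : ∀ k a {j} → j < suc k → suc k * a + j < suc k * suc a
[1+k]*a+j<[1+k]*[1+a] k a {j} j<K = subst (suc k * a + j <_) (trans (+-comm (suc k * a) (suc k)) (sym (*-suc (suc k) a)))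
                       (+-monoʳ-< (suc k * a) j<K)

ascending-slots : ∀ {k pu pz ps pt} → pu < pz → pz ≤ pt → ps ≤ pu → EarSlots k pu pz ps pt
ascending-slots {k} {pu} {pz} {ps} {pt} pu<pz pz≤pt ps≤pu = record
  { ascending = true
  ; slot = slot
  ; slot-injective = λ _ _ eq → suc-injective (+-cancelˡ-≡ (K * pu) _ _ eq)
  ; slot-fresh = fresh
  ; source<slot = λ _ → ≤-<-trans (*-monoʳ-≤ K ps≤pu) (m<m+n (K * pu) z<s)
  ; slot<sink = λ i<k → <-≤-trans (below-z (s≤s i<k)) (*-monoʳ-≤ K pz≤pt)
  ; ordered-first = m<m+n (K * pu) z<s
  ; ordered-next = λ {i} _ → +-monoʳ-< (K * pu) (n<1+n (suc i))
  ; ordered-last = below-z (n<1+n k)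
  }
  where
  K : ℕ
  K = suc k
  slot : ℕ → ℕ
  slot j = K * pu + j
  below-z : ∀ {j} → j < K → slot j < K * pz
  below-z j<K = <-≤-trans ([1+k]*a+j<[1+k]*[1+a] k pu j<K) (*-monoʳ-≤ K pu<pz)
  fresh : ∀ a {i} → i < k → K * a ≢ slot (suc i)
  fresh a {i} i<k eq with a ≤? pu
  ... | yes a≤pu = <-irrefl eq (≤-<-trans (*-monoʳ-≤ K a≤pu) (m<m+n (K * pu) z<s))
  ... | no a≰pu = <-irrefl (sym eq) (<-≤-trans ([1+k]*a+j<[1+k]*[1+a] k pu (s≤s i<k)) (*-monoʳ-≤ K (≰⇒> a≰pu)))

descending-slots : ∀ {k pu pz ps pt} → 0 < k → pz < pu → ps ≤ pz → pu ≤ pt → EarSlots k pu pz ps pt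
descending-slots {k} {pu} {pz} {ps} {pt} 0<k pz<pu ps≤pz pu≤pt = record
  { ascending = false
  ; slot = slot
  ; slot-injective = λ i<k j<k eq → suc-injective (∸-cancelˡ-≡ (j≤top (s≤s i<k)) (j≤top (s≤s j<k)) eq)
  ; slot-fresh = fresh
  ; source<slot = λ i<k → ≤-<-trans (*-monoʳ-≤ K ps≤pz) (above-z (s≤s i<k))
  ; slot<sink = λ i<k → <-≤-trans (below-top z<s (s≤s i<k)) (*-monoʳ-≤ K pu≤pt)
  ; ordered-first = below-top z<s (s≤s 0<k)
  ; ordered-next = λ {i} si<k → ∸-monoʳ-< (n<1+n (suc i)) (j≤top (s≤s si<k))
  ; ordered-last = above-z (n<1+n k)
  }
  where
  K top : ℕ
  K = suc k
  top = K * pu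
  slot : ℕ → ℕ
  slot j = top ∸ j
  z+j<top : ∀ {j} → j < K → K * pz + j < top
  z+j<top j<K = <-≤-trans ([1+k]*a+j<[1+k]*[1+a] k pz j<K) (*-monoʳ-≤ K pz<pu)
  j≤top : ∀ {j} → j < K → j ≤ top
  j≤top {j} j<K = ≤-trans (m≤n+m j (K * pz)) (<⇒≤ (z+j<top j<K))
  above-z : ∀ {j} → j < K → K * pz < slot j
  above-z {j} j<K = m+n≤o⇒m≤o∸n (suc (K * pz)) (z+j<top j<K)
  below-top : ∀ {j} → 0 < j → j < K → slot j < top
  below-top {j} 0<j j<K = ∸-monoʳ-< {top} {j} {0} 0<j (j≤top j<K)
  fresh : ∀ a {i} → i < k → K * a ≢ slot (suc i)
  fresh a {i} i<k eq with pu ≤? a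
  ... | yes pu≤a = <-irrefl (sym eq) (<-≤-trans (below-top z<s (s≤s i<k)) (*-monoʳ-≤ K pu≤a))
  ... | no pu≰a = <-irrefl a+i≡top (<-≤-trans ([1+k]*a+j<[1+k]*[1+a] k a (s≤s i<k)) (*-monoʳ-≤ K (≰⇒> pu≰a)))
    where
    a+i≡top : K * a + suc i ≡ top
    a+i≡top = trans (cong (_+ suc i) eq) (m∸n+n≡m (j≤top (s≤s i<k)))

indexOf : Fin n → List (Fin n) → ℕ
indexOf y [] = 0
indexOf y (x ∷ xs) = if does (y ≟ᶠ x) then 0 else suc (indexOf y xs)

indexOf-here : ∀ (y : Fin n) xs → indexOf y (y ∷ xs) ≡ 0
indexOf-here y xs rewrite dec-true (y ≟ᶠ y) refl = refl

indexOf-there : ∀ {y x : Fin n} xs → y ≢ x → indexOf y (x ∷ xs) ≡ suc (indexOf y xs)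
indexOf-there {y = y} {x} xs y≢x rewrite dec-false (y ≟ᶠ x) y≢x = refl

indexOf<length : ∀ {y : Fin n} xs → y ∈ xs → indexOf y xs < length xs
indexOf<length {y = y} (x ∷ xs) y∈ with y ≟ᶠ x | y∈
... | yes _ | _ = s≤s z≤n
... | no y≢x | here y≡x = contradiction y≡x y≢x
... | no _ | there y∈xs = s≤s (indexOf<length xs y∈xs)

indexOf-injective : ∀ {y y′ : Fin n} xs → y ∈ xs → y′ ∈ xs → indexOf y xs ≡ indexOf y′ xs → y ≡ y′
indexOf-injective {y = y} {y′} (x ∷ xs) y∈ y′∈ eq with y ≟ᶠ x | y′ ≟ᶠ x | y∈ | y′∈
... | yes y≡x | yes y′≡x | _ | _ = trans y≡x (sym y′≡x)
... | yes _ | no _ | _ | _ = contradiction eq 0≢1+n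
... | no _ | yes _ | _ | _ = contradiction (sym eq) 0≢1+n
... | no y≢x | no _ | here y≡x | _ = contradiction y≡x y≢x
... | no _ | no y′≢x | there _ | here y′≡x = contradiction y′≡x y′≢x
... | no _ | no _ | there y∈xs | there y′∈xs = indexOf-injective xs y∈xs y′∈xs (suc-injective eq)

module _ (G : Graph n) where

  data Chain (z : Fin n) : Fin n → Set where
    final : ∀ {x} → Edge G x z → Chain z x
    _▸_ : ∀ {x y} → Edge G x y → Chain z y → Chain z x

  vertices : ∀ {z x} → Chain z x → List (Fin n)
  vertices (final {x} _) = x ∷ []
  vertices (_▸_ {x} _ c) = x ∷ vertices c

  head∈vertices : ∀ {z x} (c : Chain z x) → x ∈ vertices c
  head∈vertices (final _) = here refl
  head∈vertices (_ ▸ _) = here refl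

  indexOf-head : ∀ {z x} (c : Chain z x) → indexOf x (vertices c) ≡ 0
  indexOf-head (final {x} _) = indexOf-here x []
  indexOf-head (_▸_ {x} _ c) = indexOf-here x (vertices c)

  chain-suffix : ∀ {z x a} (c : Chain z x) → a ∈ vertices c → ∃ λ (c′ : Chain z a) →
                 (∀ {P : Fin n → Set} → All P (vertices c) → All P (vertices c′)) ×
                 (Unique (vertices c) → Unique (vertices c′))
  chain-suffix (final e) (here refl) = final e , (λ ps → ps) , (λ u → u)
  chain-suffix (e ▸ c) (here refl) = e ▸ c , (λ ps → ps) , (λ u → u)
  chain-suffix (e ▸ c) (there a∈c) with chain-suffix c a∈c
  ... | c′ , keep-all , keep-unique = c′ , (λ { (_ ∷ ps) → keep-all ps }) , (λ { (_ ∷ u) → keep-unique u })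

  chain-successor : ∀ {z x} (c : Chain z x) → Unique (vertices c) → ∀ {y} → y ∈ vertices c →
    (Edge G y z × suc (indexOf y (vertices c)) ≡ length (vertices c))
    ⊎ ∃ λ y′ → y′ ∈ vertices c × Edge G y y′ × indexOf y′ (vertices c) ≡ suc (indexOf y (vertices c))
  chain-successor (final {x} e) _ (here refl) = inj₁ (e , cong suc (indexOf-here x []))
  chain-successor (_▸_ {x} {y₂} e c) (x∉c ∷ _) (here refl) = inj₂ (y₂ , there (head∈vertices c) , e ,
    trans (indexOf-there (vertices c) (λ eq → All.lookup x∉c (head∈vertices c) (sym eq)))
          (cong suc (trans (indexOf-head c) (sym (indexOf-here x (vertices c))))))
  chain-successor (_▸_ {x} e c) (x∉c ∷ c!) {y} (there y∈c) with chain-successor c c! y∈c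
  ... | inj₁ (e′ , is-last) = inj₁ (e′ , trans (cong suc (indexOf-there (vertices c) y≢x)) (cong suc is-last))
    where
    y≢x : y ≢ x
    y≢x eq = All.lookup x∉c y∈c (sym eq)
  ... | inj₂ (y′ , y′∈c , e′ , is-next) = inj₂ (y′ , there y′∈c , e′ ,
    trans (indexOf-there (vertices c) (λ eq → All.lookup x∉c y′∈c (sym eq)))
          (trans (cong suc is-next) (cong suc (sym (indexOf-there (vertices c) (λ eq → All.lookup x∉c y∈c (sym eq)))))))

  chain-predecessor : ∀ {z x} (c : Chain z x) → Unique (vertices c) → ∀ {y} → y ∈ vertices c →
    y ≡ x ⊎ ∃ λ y′ → y′ ∈ vertices c × Edge G y y′ × suc (indexOf y′ (vertices c)) ≡ indexOf y (vertices c)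
  chain-predecessor (final _) _ (here refl) = inj₁ refl
  chain-predecessor (_ ▸ _) _ (here refl) = inj₁ refl
  chain-predecessor (_▸_ {x} e c) (x∉c ∷ c!) {y} (there y∈c) with chain-predecessor c c! y∈c
  ... | inj₁ refl = inj₂ (x , here refl , edge-sym G e ,
    trans (cong suc (indexOf-here x (vertices c)))
          (sym (trans (indexOf-there (vertices c) (λ eq → All.lookup x∉c y∈c (sym eq))) (cong suc (indexOf-head c)))))
  ... | inj₂ (y′ , y′∈c , e′ , is-prev) = inj₂ (y′ , there y′∈c , e′ ,
    trans (cong suc (indexOf-there (vertices c) (λ eq → All.lookup x∉c y′∈c (sym eq))))
          (trans (cong suc is-prev) (sym (indexOf-there (vertices c) (λ eq → All.lookup x∉c y∈c (sym eq))))))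

-- Starting from an edge vt, repeatedly attach an ear: a path through unnumbered vertices between two
-- distinct numbered ones. It exists because G stays connected when its first end u is removed.
module STConstruction {n : ℕ} (G : Graph n) (conn : ConnectedGraph G) (ncv : NoCutVertex G)
                      (v : Fin n) (n≥3 : 3 ≤ n) where
  open import Data.List.Membership.DecPropositional (_≟ᶠ_ {n}) using (_∈?_)

  sink-choice : ∃ (Edge G v)
  sink-choice = walk-first-step (conn v (proj₁ other)) (λ v≡other → proj₂ other (sym v≡other))
    where
    other : ∃ (_≢ v)
    other = another-vertex (≤-trans (s≤s (s≤s z≤n)) n≥3) v

  t : Fin n
  t = proj₁ sink-choice

  vt : Edge G v t
  vt = proj₂ sink-choice

  t≢v : t ≢ v
  t≢v t≡v = edge-irrefl G vt (sym t≡v)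

  record PartialNumbering : Set where
    field
      U : Fin n → Bool
      pos : Fin n → ℕ
      v∈U : U v ≡ true
      t∈U : U t ≡ true
      pos-injective : ∀ {x y} → U x ≡ true → U y ≡ true → pos x ≡ pos y → x ≡ y
      v-first : ∀ {x} → U x ≡ true → x ≢ v → pos v < pos x
      t-last : ∀ {x} → U x ≡ true → x ≢ t → pos x < pos t
      lower : ∀ {x} → U x ≡ true → x ≢ v → ∃ λ y → U y ≡ true × Edge G x y × pos y < pos x
      higher : ∀ {x} → U x ≡ true → x ≢ t → ∃ λ y → U y ≡ true × Edge G x y × pos x < pos y

    unnumbered : ℕ
    unnumbered = count (not ∘ U)

  initial : PartialNumbering
  initial = record
    { U = U₀ ; pos = pos₀
    ; v∈U = dec-true (v ≟ᶠ v ⊎-dec v ≟ᶠ t) (inj₁ refl)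
    ; t∈U = dec-true (t ≟ᶠ v ⊎-dec t ≟ᶠ t) (inj₂ refl)
    ; pos-injective = injective
    ; v-first = λ {x} x∈U x≢v → case x∈U (λ x≡v → contradiction x≡v x≢v) (λ { refl → v<t })
    ; t-last = λ {x} x∈U x≢t → case x∈U (λ { refl → v<t }) (λ x≡t → contradiction x≡t x≢t)
    ; lower = λ {x} x∈U x≢v → case x∈U (λ x≡v → contradiction x≡v x≢v)
                                        (λ { refl → v , dec-true (v ≟ᶠ v ⊎-dec v ≟ᶠ t) (inj₁ refl) , edge-sym G vt , v<t })
    ; higher = λ {x} x∈U x≢t → case x∈U (λ { refl → t , dec-true (t ≟ᶠ v ⊎-dec t ≟ᶠ t) (inj₂ refl) , vt , v<t })
                                         (λ x≡t → contradiction x≡t x≢t)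
    }
    where
    U₀ : Fin n → Bool
    U₀ x = does (x ≟ᶠ v ⊎-dec x ≟ᶠ t)
    pos₀ : Fin n → ℕ
    pos₀ x = if does (x ≟ᶠ v) then 0 else 1
    case : ∀ {x} {A : Set} → U₀ x ≡ true → (x ≡ v → A) → (x ≡ t → A) → A
    case {x} x∈U₀ at-v at-t with does-true (x ≟ᶠ v ⊎-dec x ≟ᶠ t) x∈U₀
    ... | inj₁ x≡v = at-v x≡v
    ... | inj₂ x≡t = at-t x≡t
    v<t : pos₀ v < pos₀ t
    v<t rewrite dec-true (v ≟ᶠ v) refl | dec-false (t ≟ᶠ v) t≢v = z<s
    injective : ∀ {x y} → U₀ x ≡ true → U₀ y ≡ true → pos₀ x ≡ pos₀ y → x ≡ y
    injective {x} {y} x∈U₀ y∈U₀ eq = case {x} x∈U₀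
      (λ { refl → case {y} y∈U₀ (λ y≡v → sym y≡v) (λ { refl → contradiction eq (<⇒≢ v<t) }) })
      (λ { refl → case {y} y∈U₀ (λ { refl → contradiction (sym eq) (<⇒≢ v<t) }) (λ y≡t → sym y≡t) })

  record Ear (st : PartialNumbering) (u w : Fin n) : Set where
    field
      end : Fin n
      chain : Chain G end w
      end∈U : PartialNumbering.U st end ≡ true
      end≢u : end ≢ u
      fresh : All (λ y → PartialNumbering.U st y ≡ false) (vertices G chain)
      simple : Unique (vertices G chain)

  ear-from-walk : (st : PartialNumbering) (u : Fin n) → ∀ {a b} → Walk (EdgeAvoiding G u) a b →
                  PartialNumbering.U st a ≡ false → PartialNumbering.U st b ≡ true → Ear st u a
  ear-from-walk st u here a∉U b∈U = contradiction (trans (sym b∈U) a∉U) true≢false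
  ear-from-walk st u {a} (step {y = a′} (e , _ , a′≢u) walk) a∉U b∈U with PartialNumbering.U st a′ in a′∈U
  ... | true = record { end = a′ ; chain = final e ; end∈U = a′∈U ; end≢u = a′≢u
                       ; fresh = a∉U ∷ [] ; simple = [] ∷ [] }
  ... | false with ear-from-walk st u walk a′∈U b∈U
  ...   | ear with a ∈? vertices G (Ear.chain ear)
  ...     | yes a∈ear = record { end = end ; chain = proj₁ shortcut ; end∈U = end∈U ; end≢u = end≢u
                               ; fresh = proj₁ (proj₂ shortcut) fresh ; simple = proj₂ (proj₂ shortcut) simple }
    where
    open Ear ear
    shortcut : ∃ λ (c′ : Chain G end a) → (∀ {P : Fin n → Set} → All P (vertices G chain) → All P (vertices G c′))
                                          × (Unique (vertices G chain) → Unique (vertices G c′))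
    shortcut = chain-suffix G chain a∈ear
  ...     | no a∉ear = record { end = end ; chain = e ▸ chain ; end∈U = end∈U ; end≢u = end≢u
                              ; fresh = a∉U ∷ fresh
                              ; simple = All.tabulate (λ a′∈ a≡a′ → a∉ear (subst (_∈ _) (sym a≡a′) a′∈)) ∷ simple }
    where open Ear ear

  module Insert (st : PartialNumbering) {u w : Fin n} (u∈U : PartialNumbering.U st u ≡ true) (uw : Edge G u w)
                (ear : Ear st u w) where
    open PartialNumbering st
    open Ear ear

    ws : List (Fin n)
    ws = vertices G chain

    k K : ℕ
    k = length ws
    K = suc k

    U′ : Fin n → Bool
    U′ y = U y ∨ does (y ∈? ws)

    U′-cases : ∀ {y} → U′ y ≡ true → U y ≡ true ⊎ y ∈ ws
    U′-cases {y} y∈U′ with ∨-elim (U y) y∈U′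
    ... | inj₁ y∈U = inj₁ y∈U
    ... | inj₂ y∈ws = inj₂ (does-true (y ∈? ws) y∈ws)

    U′-old : ∀ {y} → U y ≡ true → U′ y ≡ true
    U′-old y∈U = ∨-introˡ _ y∈U

    U′-new : ∀ {y} → y ∈ ws → U′ y ≡ true
    U′-new {y} y∈ws = ∨-introʳ (U y) (dec-true (y ∈? ws) y∈ws)

    fewer-unnumbered : count (not ∘ U′) < count (not ∘ U)
    fewer-unnumbered = count-strict (not ∘ U′) (not ∘ U) still-unnumbered w
      (cong not (U′-new (head∈vertices G chain))) (cong not (All.lookup fresh (head∈vertices G chain)))
      where
      still-unnumbered : ∀ y → not (U′ y) ≡ true → not (U y) ≡ true
      still-unnumbered y y∉U′ with U y
      ... | true = y∉U′
      ... | false = refl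

    0<k : 0 < k
    0<k with chain
    ... | final _ = z<s
    ... | _ ▸ _ = z<s

    module Placed (slots : EarSlots k (pos u) (pos end) (pos v) (pos t)) where
      open EarSlots slots

      pos′ : Fin n → ℕ
      pos′ y = if U y then K * pos y else slot (suc (indexOf y ws))

      pos′-old : ∀ {y} → U y ≡ true → pos′ y ≡ K * pos y
      pos′-old = if-true

      pos′-new : ∀ {y} → y ∈ ws → pos′ y ≡ slot (suc (indexOf y ws))
      pos′-new y∈ws = if-false (All.lookup fresh y∈ws)

      predecessor : ∀ {y} → y ∈ ws → ∃ λ p → U′ p ≡ true × Edge G y p × Ordered ascending (pos′ p) (pos′ y)
      predecessor {y} y∈ws with chain-predecessor G chain simple y∈ws
      ... | inj₁ refl = u , U′-old u∈U , edge-sym G uw ,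
            subst₂ (Ordered ascending) (sym (pos′-old u∈U))
                   (sym (trans (pos′-new y∈ws) (cong (slot ∘ suc) (indexOf-head G chain)))) ordered-first
      ... | inj₂ (y′ , y′∈ws , e , is-prev) = y′ , U′-new y′∈ws , e ,
            subst₂ (Ordered ascending) (sym (pos′-new y′∈ws)) (sym (trans (pos′-new y∈ws) (cong (slot ∘ suc) (sym is-prev))))
                   (ordered-next (subst (_< k) (sym is-prev) (indexOf<length ws y∈ws)))

      successor : ∀ {y} → y ∈ ws → ∃ λ s → U′ s ≡ true × Edge G y s × Ordered ascending (pos′ y) (pos′ s)
      successor {y} y∈ws with chain-successor G chain simple y∈ws
      ... | inj₁ (e , is-last) = end , U′-old end∈U , e ,
            subst₂ (Ordered ascending) (sym (trans (pos′-new y∈ws) (cong slot is-last))) (sym (pos′-old end∈U)) ordered-last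
      ... | inj₂ (y′ , y′∈ws , e , is-next) = y′ , U′-new y′∈ws , e ,
            subst₂ (Ordered ascending) (sym (pos′-new y∈ws)) (sym (trans (pos′-new y′∈ws) (cong (slot ∘ suc) is-next)))
                   (ordered-next (subst (_< k) is-next (indexOf<length ws y′∈ws)))

      injective : ∀ {x y} → U′ x ≡ true → U′ y ≡ true → pos′ x ≡ pos′ y → x ≡ y
      injective {x} {y} x∈U′ y∈U′ eq with U′-cases x∈U′ | U′-cases y∈U′
      ... | inj₁ x∈U | inj₁ y∈U =
            pos-injective x∈U y∈U (*-cancelˡ-≡ _ _ K (trans (sym (pos′-old x∈U)) (trans eq (pos′-old y∈U))))
      ... | inj₁ x∈U | inj₂ y∈ws = contradiction (trans (sym (pos′-old x∈U)) (trans eq (pos′-new y∈ws)))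
                                     (slot-fresh (pos x) (indexOf<length ws y∈ws))
      ... | inj₂ x∈ws | inj₁ y∈U = contradiction (trans (sym (pos′-old y∈U)) (trans (sym eq) (pos′-new x∈ws)))
                                     (slot-fresh (pos y) (indexOf<length ws x∈ws))
      ... | inj₂ x∈ws | inj₂ y∈ws = indexOf-injective ws x∈ws y∈ws
            (slot-injective (indexOf<length ws x∈ws) (indexOf<length ws y∈ws)
                            (trans (sym (pos′-new x∈ws)) (trans eq (pos′-new y∈ws))))

      v-first′ : ∀ {x} → U′ x ≡ true → x ≢ v → pos′ v < pos′ x
      v-first′ {x} x∈U′ x≢v with U′-cases x∈U′
      ... | inj₁ x∈U = subst₂ _<_ (sym (pos′-old v∈U)) (sym (pos′-old x∈U)) (*-monoʳ-< K (v-first x∈U x≢v))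
      ... | inj₂ x∈ws = subst₂ _<_ (sym (pos′-old v∈U)) (sym (pos′-new x∈ws)) (source<slot (indexOf<length ws x∈ws))

      t-last′ : ∀ {x} → U′ x ≡ true → x ≢ t → pos′ x < pos′ t
      t-last′ {x} x∈U′ x≢t with U′-cases x∈U′
      ... | inj₁ x∈U = subst₂ _<_ (sym (pos′-old x∈U)) (sym (pos′-old t∈U)) (*-monoʳ-< K (t-last x∈U x≢t))
      ... | inj₂ x∈ws = subst₂ _<_ (sym (pos′-new x∈ws)) (sym (pos′-old t∈U)) (slot<sink (indexOf<length ws x∈ws))

      lower′ : ∀ {x} → U′ x ≡ true → x ≢ v → ∃ λ y → U′ y ≡ true × Edge G x y × pos′ y < pos′ x
      lower′ {x} x∈U′ x≢v with U′-cases x∈U′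
      ... | inj₁ x∈U = let y , y∈U , e , y<x = lower x∈U x≢v in
            y , U′-old y∈U , e , subst₂ _<_ (sym (pos′-old y∈U)) (sym (pos′-old x∈U)) (*-monoʳ-< K y<x)
      ... | inj₂ x∈ws with predecessor x∈ws | successor x∈ws
      ...   | p , p∈U′ , ep , p≺x | s , s∈U′ , es , x≺s with ordered-split ascending p≺x x≺s
      ...     | inj₁ (p<x , _) = p , p∈U′ , ep , p<x
      ...     | inj₂ (s<x , _) = s , s∈U′ , es , s<x

      higher′ : ∀ {x} → U′ x ≡ true → x ≢ t → ∃ λ y → U′ y ≡ true × Edge G x y × pos′ x < pos′ y
      higher′ {x} x∈U′ x≢t with U′-cases x∈U′
      ... | inj₁ x∈U = let y , y∈U , e , x<y = higher x∈U x≢t in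
            y , U′-old y∈U , e , subst₂ _<_ (sym (pos′-old x∈U)) (sym (pos′-old y∈U)) (*-monoʳ-< K x<y)
      ... | inj₂ x∈ws with predecessor x∈ws | successor x∈ws
      ...   | p , p∈U′ , ep , p≺x | s , s∈U′ , es , x≺s with ordered-split ascending p≺x x≺s
      ...     | inj₁ (_ , x<s) = s , s∈U′ , es , x<s
      ...     | inj₂ (_ , x<p) = p , p∈U′ , ep , x<p

      extended : PartialNumbering
      extended = record { U = U′ ; pos = pos′ ; v∈U = U′-old v∈U ; t∈U = U′-old t∈U ; pos-injective = injective
                        ; v-first = v-first′ ; t-last = t-last′ ; lower = lower′ ; higher = higher′ }

    ≤-unless-≡ : ∀ {a b : Fin n} → (a ≢ b → pos a < pos b) → pos a ≤ pos b
    ≤-unless-≡ {a} {b} a<b with a ≟ᶠ b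
    ... | yes refl = ≤-refl
    ... | no a≢b = <⇒≤ (a<b a≢b)

    slots : EarSlots k (pos u) (pos end) (pos v) (pos t)
    slots with <-cmp (pos u) (pos end)
    ... | tri< u<end _ _ =
          ascending-slots u<end (≤-unless-≡ (t-last end∈U)) (≤-unless-≡ (λ v≢u → v-first u∈U (v≢u ∘ sym)))
    ... | tri≈ _ u≡end _ = contradiction (pos-injective end∈U u∈U (sym u≡end)) end≢u
    ... | tri> _ _ end<u =
          descending-slots 0<k end<u (≤-unless-≡ (λ v≢end → v-first end∈U (v≢end ∘ sym))) (≤-unless-≡ (t-last u∈U))

    extended : PartialNumbering
    extended = Placed.extended slots

  EdgeAvoiding? : ∀ u x y → Dec (EdgeAvoiding G u x y)
  EdgeAvoiding? u x y = adj G x y ≟ᵇ true ×-dec ¬? (x ≟ᶠ u) ×-dec ¬? (y ≟ᶠ u)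

  walk-avoiding : ∀ u {a b} → a ≢ u → b ≢ u → Walk (EdgeAvoiding G u) a b
  walk-avoiding u {a} {b} a≢u b≢u with walk? (EdgeAvoiding? u) a b
  ... | yes walk = walk
  ... | no no-walk = ⊥-elim (ncv u (a , b , a≢u , b≢u , no-walk))

  extend : (st : PartialNumbering) → ∀ {x} → PartialNumbering.U st x ≡ false →
           Σ PartialNumbering λ st′ → PartialNumbering.unnumbered st′ < PartialNumbering.unnumbered st
  extend st {x} x∉U with walk-exits (PartialNumbering.U st) (conn v x) (PartialNumbering.v∈U st) x∉U
  ... | u , w , u∈U , w∉U , uw = Insert.extended st u∈U uw ear , Insert.fewer-unnumbered st u∈U uw ear
    where
    open PartialNumbering st
    w≢u : w ≢ u
    w≢u refl = true≢false (trans (sym u∈U) w∉U)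
    anchor : ∃ λ z → U z ≡ true × z ≢ u
    anchor with u ≟ᶠ v
    ... | yes refl = t , t∈U , t≢v
    ... | no u≢v = v , v∈U , u≢v ∘ sym
    ear : Ear st u w
    ear = ear-from-walk st u (walk-avoiding u w≢u (proj₂ (proj₂ anchor))) w∉U (proj₁ (proj₂ anchor))

  complete : Σ PartialNumbering λ st → ∀ x → PartialNumbering.U st x ≡ true
  complete = go initial (<-wellFounded _)
    where
    go : (st : PartialNumbering) → Acc _<_ (PartialNumbering.unnumbered st) →
         Σ PartialNumbering λ st → ∀ x → PartialNumbering.U st x ≡ true
    go st (acc rec) with any? (λ x → PartialNumbering.U st x ≟ᵇ false)
    ... | no none = st , λ x → ¬-not λ x∉U → none (x , x∉U)
    ... | yes (_ , x∉U) with extend st x∉U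
    ...   | st′ , fewer = go st′ (rec fewer)

  module Ranked (st : PartialNumbering) (total : ∀ x → PartialNumbering.U st x ≡ true) where
    open PartialNumbering st

    rank : Fin n → ℕ
    rank = rankBy pos

    rank-mono : ∀ {x y} → pos x < pos y → rank x < rank y
    rank-mono = rankBy-mono pos

    rank-injective : ∀ {x y} → rank x ≡ rank y → x ≡ y
    rank-injective {x} {y} eq with <-cmp (pos x) (pos y)
    ... | tri< x<y _ _ = contradiction eq (<⇒≢ (rank-mono x<y))
    ... | tri≈ _ x≡y _ = pos-injective (total x) (total y) x≡y
    ... | tri> _ _ y<x = contradiction (sym eq) (<⇒≢ (rank-mono y<x))

    rank-v : rank v ≡ 0
    rank-v = rankBy-minimum pos below-v
      where
      below-v : ∀ y → ¬ pos y < pos v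
      below-v y y<v with y ≟ᶠ v
      ... | yes refl = <-irrefl refl y<v
      ... | no y≢v = <-asym y<v (v-first (total y) y≢v)

    rank<t : ∀ {x} → x ≢ t → rank x < rank t
    rank<t x≢t = rank-mono (t-last (total _) x≢t)

    rank-t : suc (rank t) ≡ n
    rank-t = ≤-antisym (rankBy<n pos t) (≮⇒≥ beyond-t)
      where
      beyond-t : ¬ suc (rank t) < n
      beyond-t 1+t<n with injective-below⇒surjective rank (rankBy<n pos) rank-injective 1+t<n
      ... | x , rank-x with x ≟ᶠ t
      ...   | yes refl = 1+n≢n (sym rank-x)
      ...   | no x≢t = <-asym (rank<t x≢t) (subst (rank t <_) (sym rank-x) (n<1+n _))

    top-neighbour : ∀ {q y} → suc (rank q) ≡ rank t → pos q < pos y → y ≡ t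
    top-neighbour {q} {y} q+1≡t q<y with y ≟ᶠ t
    ... | yes y≡t = y≡t
    ... | no y≢t = contradiction (rank<t y≢t) (≤⇒≯ (subst (_≤ rank y) q+1≡t (rank-mono q<y)))

    0<rank-t : 0 < rank t
    0<rank-t = subst (_< rank t) rank-v (rank<t (t≢v ∘ sym))

    predecessor-of-t : ∃ λ q → suc (rank q) ≡ rank t × Edge G q t
    predecessor-of-t
      with injective-below⇒surjective rank (rankBy<n pos) rank-injective (≤-<-trans (m∸n≤m (rank t) 1) (rankBy<n pos t))
    ... | q , q≡t-1 with trans (cong suc q≡t-1) (suc[m∸1]≡m 0<rank-t)
    ...   | 1+q≡t with higher (total q) (λ { refl → 1+n≢n 1+q≡t })
    ...     | y , _ , qy , q<y = q , 1+q≡t , subst (Edge G q) (top-neighbour 1+q≡t q<y) qy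

    -- down v is a junk value: an st-numbering only uses down x when 0 < pos x.
    down : Fin n → Fin n
    down x with x ≟ᶠ t | x ≟ᶠ v
    ... | yes _ | _ = proj₁ predecessor-of-t
    ... | no _ | yes _ = v
    ... | no _ | no x≢v = proj₁ (lower (total x) x≢v)

    up : Fin n → Fin n
    up x with x ≟ᶠ t
    ... | yes _ = t
    ... | no x≢t = proj₁ (higher (total x) x≢t)

    down-edge : ∀ x → 0 < rank x → Edge G x (down x)
    down-edge x 0<x with x ≟ᶠ t | x ≟ᶠ v
    ... | yes refl | _ = edge-sym G (proj₂ (proj₂ predecessor-of-t))
    ... | no _ | yes refl = contradiction rank-v (>⇒≢ 0<x)
    ... | no _ | no x≢v = proj₁ (proj₂ (proj₂ (lower (total x) x≢v)))

    down-lower : ∀ x → 0 < rank x → rank (down x) < rank x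
    down-lower x 0<x with x ≟ᶠ t | x ≟ᶠ v
    ... | yes refl | _ = ≤-reflexive (proj₁ (proj₂ predecessor-of-t))
    ... | no _ | yes refl = contradiction rank-v (>⇒≢ 0<x)
    ... | no _ | no x≢v = rank-mono (proj₂ (proj₂ (proj₂ (lower (total x) x≢v))))

    down-t : suc (rank (down t)) ≡ rank t
    down-t with t ≟ᶠ t
    ... | yes _ = proj₁ (proj₂ predecessor-of-t)
    ... | no t≢t = contradiction refl t≢t

    up-edge : ∀ x → suc (rank x) < n → Edge G x (up x)
    up-edge x below-top with x ≟ᶠ t
    ... | yes refl = contradiction rank-t (<⇒≢ below-top)
    ... | no x≢t = proj₁ (proj₂ (proj₂ (higher (total x) x≢t)))

    up-higher : ∀ x → suc (rank x) < n → rank x < rank (up x)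
    up-higher x below-top with x ≟ᶠ t
    ... | yes refl = contradiction rank-t (<⇒≢ below-top)
    ... | no x≢t = rank-mono (proj₂ (proj₂ (proj₂ (higher (total x) x≢t))))

    numbering : STNumbering G v
    numbering = record
      { pos = rank ; pos<n = rankBy<n pos ; pos-injective = rank-injective ; pos-source = rank-v
      ; sink = t ; pos-sink = rank-t ; source-sink = vt ; down = down ; up = up
      ; down-edge = down-edge ; down-lower = down-lower ; down-sink = down-t
      ; up-edge = up-edge ; up-higher = up-higher }

  st-numbering : STNumbering G v
  st-numbering = Ranked.numbering (proj₁ complete) (proj₂ complete)

-- The family of 1 + n(n+1)/2 connected subgraphs

-- Removed a x y: xy is the edge e_a, from the vertex at position a + 1 to its down-neighbour, or vt
-- for a = n - 1. member a b keeps the vertices at positions ≤ a or > b and the edges between them,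
-- except e_a when a = b.
module Family {n : ℕ} {G : Graph n} {v : Fin n} (S : STNumbering G v) (n≥3 : 3 ≤ n) where
  open STNumbering S

  RemovedEdge : ℕ → Fin n → Fin n → Set
  RemovedEdge a x y = (pos x ≡ suc a × y ≡ down x) ⊎ (suc a ≡ n × x ≡ v × y ≡ sink)

  Removed : ℕ → Fin n → Fin n → Set
  Removed a x y = RemovedEdge a x y ⊎ RemovedEdge a y x

  removed? : ∀ a x y → Dec (Removed a x y)
  removed? a x y = removedEdge? x y ⊎-dec removedEdge? y x
    where
    removedEdge? : ∀ x y → Dec (RemovedEdge a x y)
    removedEdge? x y = (pos x ≟ suc a ×-dec y ≟ᶠ down x) ⊎-dec (suc a ≟ n ×-dec x ≟ᶠ v ×-dec y ≟ᶠ sink)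

  removed-sym : ∀ {a x y} → Removed a x y → Removed a y x
  removed-sym (inj₁ r) = inj₂ r
  removed-sym (inj₂ r) = inj₁ r

  source≢sink : v ≢ sink
  source≢sink = edge-irrefl G source-sink

  removedEdge-index : ∀ {a a′ x y} → RemovedEdge a x y → RemovedEdge a′ x y → a ≡ a′
  removedEdge-index (inj₁ (x≡1+a , _)) (inj₁ (x≡1+a′ , _)) = suc-injective (trans (sym x≡1+a) x≡1+a′)
  removedEdge-index (inj₁ (x≡1+a , _)) (inj₂ (_ , refl , _)) = contradiction (trans (sym x≡1+a) pos-source) 1+n≢0
  removedEdge-index (inj₂ (_ , refl , _)) (inj₁ (x≡1+a′ , _)) = contradiction (trans (sym x≡1+a′) pos-source) 1+n≢0
  removedEdge-index (inj₂ (1+a≡n , _)) (inj₂ (1+a′≡n , _)) = suc-injective (trans 1+a≡n (sym 1+a′≡n))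

  removedEdge-not-reversed : ∀ {a a′ x y} → RemovedEdge a x y → RemovedEdge a′ y x → ⊥
  removedEdge-not-reversed {x = x} (inj₁ (x≡1+a , refl)) (inj₁ (y≡1+a′ , x≡down-y)) =
    <-asym (down-lower x (subst (0 <_) (sym x≡1+a) z<s))
           (subst (λ z → pos z < pos (down x)) (sym x≡down-y) (down-lower (down x) (subst (0 <_) (sym y≡1+a′) z<s)))
  removedEdge-not-reversed (inj₁ (_ , refl)) (inj₂ (_ , down-x≡v , refl)) = down-sink≢source n≥3 down-x≡v
  removedEdge-not-reversed (inj₂ (_ , x≡v , refl)) (inj₁ (_ , x≡down-y)) = down-sink≢source n≥3 (trans (sym x≡down-y) x≡v)
  removedEdge-not-reversed (inj₂ (_ , x≡v , _)) (inj₂ (_ , _ , x≡sink)) = source≢sink (trans (sym x≡v) x≡sink)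

  removed-index : ∀ {a a′ x y} → Removed a x y → Removed a′ x y → a ≡ a′
  removed-index (inj₁ r) (inj₁ r′) = removedEdge-index r r′
  removed-index (inj₁ r) (inj₂ r′) = contradiction r′ (removedEdge-not-reversed r)
  removed-index (inj₂ r) (inj₁ r′) = contradiction r (removedEdge-not-reversed r′)
  removed-index (inj₂ r) (inj₂ r′) = removedEdge-index r r′

  removed-edge : ∀ {a} → a < n → ∃₂ λ x y → Edge G x y × RemovedEdge a x y
  removed-edge {a} a<n with suc a <? n
  ... | yes 1+a<n = at 1+a<n , down (at 1+a<n) , down-edge _ (subst (0 <_) (sym (pos-at 1+a<n)) z<s) ,
                    inj₁ (pos-at 1+a<n , refl)
  ... | no 1+a≮n = v , sink , source-sink , inj₂ (≤-antisym a<n (≮⇒≥ 1+a≮n) , refl , refl)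

  Kept : ℕ → ℕ → Fin n → Set
  Kept a b x = pos x ≤ a ⊎ b < pos x

  kept? : ∀ a b x → Dec (Kept a b x)
  kept? a b x = pos x ≤? a ⊎-dec b <? pos x

  kept-all : ∀ a x → Kept a a x
  kept-all a x with pos x ≤? a
  ... | yes x≤a = inj₁ x≤a
  ... | no x≰a = inj₂ (≰⇒> x≰a)

  KeptEdge : ℕ → ℕ → Fin n → Fin n → Set
  KeptEdge a b x y = Edge G x y × Kept a b x × Kept a b y × ¬ (a ≡ b × Removed a x y)

  keptEdge? : ∀ a b x y → Dec (KeptEdge a b x y)
  keptEdge? a b x y = adj G x y ≟ᵇ true ×-dec kept? a b x ×-dec kept? a b y ×-dec ¬? (a ≟ b ×-dec removed? a x y)

  keptEdge-sym : ∀ {a b x y} → KeptEdge a b x y → KeptEdge a b y x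
  keptEdge-sym (e , kx , ky , ¬removed) = edge-sym G e , ky , kx , λ (a≡b , r) → ¬removed (a≡b , removed-sym r)

  member : ℕ → ℕ → SubData n
  member a b = subgraph (kept? a b) (keptEdge? a b)

  whole : SubData n
  whole = subgraph {V = λ _ → ⊤} (λ _ → yes tt) (λ x y → adj G x y ≟ᵇ true)

  source-kept : ∀ {a b} → Kept a b v
  source-kept {a} = inj₁ (subst (_≤ a) (sym pos-source) z≤n)

  down-kept : ∀ {a b x} → pos x ≤ a → 0 < pos x → KeptEdge a b x (down x)
  down-kept {a} {b} {x} x≤a 0<x = down-edge x 0<x , inj₁ x≤a , inj₁ down≤a , not-removed
    where
    down≤a : pos (down x) ≤ a
    down≤a = ≤-trans (<⇒≤ (down-lower x 0<x)) x≤a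
    not-removed : ¬ (a ≡ b × Removed a x (down x))
    not-removed (_ , inj₁ (inj₁ (x≡1+a , _))) = <-irrefl refl (subst (_≤ a) x≡1+a x≤a)
    not-removed (_ , inj₁ (inj₂ (_ , refl , _))) = <-irrefl (sym pos-source) 0<x
    not-removed (_ , inj₂ (inj₁ (down≡1+a , _))) = <-irrefl refl (subst (_≤ a) down≡1+a down≤a)
    not-removed (_ , inj₂ (inj₂ (_ , down≡v , refl))) = down-sink≢source n≥3 down≡v

  up-kept : ∀ {a b x} → b < pos x → suc (pos x) < n → KeptEdge a b x (up x)
  up-kept {a} {b} {x} b<x x<top = up-edge x x<top , inj₂ b<x , inj₂ (<-trans b<x x<up) , not-removed
    where
    x<up : pos x < pos (up x)
    x<up = up-higher x x<top
    0<x : 0 < pos x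
    0<x = ≤-<-trans z≤n b<x
    not-removed : ¬ (a ≡ b × Removed a x (up x))
    not-removed (_ , inj₁ (inj₁ (_ , up≡down))) = <-asym (down-lower x 0<x) (subst (λ z → pos x < pos z) up≡down x<up)
    not-removed (_ , inj₁ (inj₂ (_ , refl , _))) = <-irrefl (sym pos-source) 0<x
    not-removed (refl , inj₂ (inj₁ (up≡1+a , _))) = <-irrefl refl (<-≤-trans x<up (subst (_≤ pos x) (sym up≡1+a) b<x))
    not-removed (_ , inj₂ (inj₂ (_ , up≡v , _))) = <-irrefl (sym (trans (cong pos up≡v) pos-source)) (≤-<-trans z≤n x<up)

  sink-source-kept : ∀ {a b} → b < pos sink → KeptEdge a b sink v
  sink-source-kept {a} {b} b<sink = edge-sym G source-sink , inj₂ b<sink , source-kept , not-removed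
    where
    not-removed : ¬ (a ≡ b × Removed a sink v)
    not-removed (_ , inj₁ (inj₁ (_ , v≡down-sink))) = down-sink≢source n≥3 (sym v≡down-sink)
    not-removed (_ , inj₁ (inj₂ (_ , sink≡v , _))) = source≢sink (sym sink≡v)
    not-removed (_ , inj₂ (inj₁ (v≡1+a , _))) = 1+n≢0 (trans (sym v≡1+a) pos-source)
    not-removed (refl , inj₂ (inj₂ (1+a≡n , _))) = <-irrefl 1+a≡n (subst (suc a <_) pos-sink (s≤s b<sink))

  member-connected : ∀ a {b} → b < n → ConnSubContaining G v (member a b)
  member-connected a {b} b<n = subgraph-connected (kept? a b) (keptEdge? a b) G keptEdge-sym
    (λ (e , kx , ky , _) → e , kx , ky) source-kept to-source
    where
    to-source : ∀ x → Kept a b x → Walk (KeptEdge a b) x v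
    to-source x (inj₁ x≤a) = walk-down (λ y → pos y ≤ a)
      (λ y y≤a 0<y → down-kept y≤a 0<y , ≤-trans (<⇒≤ (down-lower y 0<y)) y≤a) x x≤a
    to-source x (inj₂ b<x) = walk-up (λ y → b < pos y) (λ y b<y y<top → up-kept b<y y<top , <-trans b<y (up-higher y y<top)) x b<x
                             ◅◅ step (sink-source-kept (<-≤-trans b<x (pos≤pos-sink x))) here

  whole-connected : ConnSubContaining G v whole
  whole-connected = subgraph-connected {V = λ _ → ⊤} (λ _ → yes tt) (λ x y → adj G x y ≟ᵇ true) G (edge-sym G)
    (λ e → e , tt , tt) tt (λ x _ → walk-down (λ _ → ⊤) (λ y _ 0<y → down-edge y 0<y , tt) x tt)

  gap : ∀ {a b p} → a < p → p ≤ b → b < n → ∃ λ x → pos x ≡ p × ¬ Kept a b x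
  gap {a} {b} {p} a<p p≤b b<n = at p<n , pos-at p<n , not-kept
    where
    p<n : p < n
    p<n = ≤-<-trans p≤b b<n
    not-kept : ¬ Kept a b (at p<n)
    not-kept (inj₁ x≤a) = <-irrefl refl (<-≤-trans a<p (subst (_≤ a) (pos-at p<n) x≤a))
    not-kept (inj₂ b<x) = <-irrefl refl (<-≤-trans b<x (subst (_≤ b) (sym (pos-at p<n)) p≤b))

  kept-⊆-bounds : ∀ {a b a′ b′} → a < b → b < n → (∀ x → Kept a′ b′ x → Kept a b x) → a′ ≤ a × b ≤ b′
  kept-⊆-bounds {a} {b} {a′} {b′} a<b b<n ⊆ = ≮⇒≥ lower-gap , ≮⇒≥ upper-gap
    where
    lower-gap : ¬ a < a′
    lower-gap a<a′ with gap {p = suc a} ≤-refl a<b b<n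
    ... | x , x≡1+a , ¬kept = ¬kept (⊆ x (inj₁ (subst (_≤ a′) (sym x≡1+a) a<a′)))
    upper-gap : ¬ b′ < b
    upper-gap b′<b with gap {p = b} a<b ≤-refl b<n
    ... | x , x≡b , ¬kept = ¬kept (⊆ x (inj₂ (subst (b′ <_) (sym x≡b) b′<b)))

  ¬all-kept : ∀ {a b} → a < b → b < n → ¬ (∀ x → Kept a b x)
  ¬all-kept a<b b<n all-kept with gap {p = suc _} ≤-refl a<b b<n
  ... | x , _ , ¬kept = ¬kept (all-kept x)

  member-injective : ∀ {a b a′ b′} → a ≤ b → b < n → a′ ≤ b′ → b′ < n →
                     member a b ≡ member a′ b′ → (a , b) ≡ (a′ , b′)
  member-injective {a} {b} {a′} {b′} a≤b b<n a′≤b′ b′<n eq with m≤n⇒m<n∨m≡n a≤b | m≤n⇒m<n∨m≡n a′≤b′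
  ... | inj₁ a<b | inj₁ a′<b′ =
    let a′≤a , b≤b′ = kept-⊆-bounds a<b b<n (λ _ → subgraph-≡⇒V (sym eq))
        a≤a′ , b′≤b = kept-⊆-bounds a′<b′ b′<n (λ _ → subgraph-≡⇒V eq)
    in cong₂ _,_ (≤-antisym a≤a′ a′≤a) (≤-antisym b≤b′ b′≤b)
  ... | inj₁ a<b | inj₂ refl = ⊥-elim (¬all-kept a<b b<n λ x → subgraph-≡⇒V (sym eq) (kept-all a′ x))
  ... | inj₂ refl | inj₁ a′<b′ = ⊥-elim (¬all-kept a′<b′ b′<n λ x → subgraph-≡⇒V eq (kept-all a x))
  ... | inj₂ refl | inj₂ refl with removed-edge b<n
  ...   | x , y , e , r with removed? a′ x y
  ...     | yes r′ = cong (λ c → c , c) (removed-index (inj₁ r) r′)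
  ...     | no ¬r′ = contradiction (subgraph-≡⇒E (sym eq) (e , kept-all a′ x , kept-all a′ y , λ (_ , r′) → ¬r′ r′))
                                   (λ (_ , _ , _ , ¬removed) → ¬removed (refl , inj₁ r))

  whole≢member : ∀ {a b} → a ≤ b → b < n → whole ≢ member a b
  whole≢member {a} {b} a≤b b<n eq with m≤n⇒m<n∨m≡n a≤b
  ... | inj₁ a<b = ¬all-kept a<b b<n λ x → subgraph-≡⇒V eq tt
  ... | inj₂ refl with removed-edge b<n
  ...   | x , y , e , r = proj₂ (proj₂ (proj₂ (subgraph-≡⇒E eq e))) (refl , inj₁ r)

  family : Fin (suc (triangle n)) → SubData n
  family fzero = whole
  family (fsuc i) = uncurry member (pair n i)

  family-connected : ∀ i → ConnSubContaining G v (family i)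
  family-connected fzero = whole-connected
  family-connected (fsuc i) = member-connected _ (proj₂ (pair-ordered n i))

  family-injective : Injective _≡_ _≡_ family
  family-injective {fzero} {fzero} _ = refl
  family-injective {fzero} {fsuc j} eq = contradiction eq (whole≢member (proj₁ (pair-ordered n j)) (proj₂ (pair-ordered n j)))
  family-injective {fsuc i} {fzero} eq = contradiction (sym eq) (whole≢member (proj₁ (pair-ordered n i)) (proj₂ (pair-ordered n i)))
  family-injective {fsuc i} {fsuc j} eq with pair-ordered n i | pair-ordered n j
  ... | a≤b , b<n | a′≤b′ , b′<n = cong fsuc (pair-injective n (member-injective a≤b b<n a′≤b′ b′<n eq))

  member-in-family : ∀ {a b} → a ≤ b → b < n → ∃ λ i → family i ≡ member a b
  member-in-family a≤b b<n with pair-surjective n a≤b b<n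
  ... | i , pair-i = fsuc i , cong (uncurry member) pair-i

  f-lower-bound : ∀ {k} → fEquals G v k → suc (triangle n) ≤ k
  f-lower-bound (xs , refl , _ , members) =
    injection-into-list⇒≤ xs family family-injective (λ i → Equivalence.from (members (family i)) (family-connected i))

-- Cycle numberings

record CycleNumbering {n : ℕ} (G : Graph n) : Set where
  field
    pos : Fin n → ℕ
    pos<n : ∀ x → pos x < n
    pos-injective : ∀ {x y} → pos x ≡ pos y → x ≡ y
    edge⇔adjacent : ∀ x y → Edge G x y ⇔ CycleAdjacent n (pos x) (pos y)

module _ {G : Graph n} where

  isoCycle⇒cycleNumbering : IsoCycle G → CycleNumbering G
  isoCycle⇒cycleNumbering (σ , adj≡cycAdj) = record
    { pos = toℕ ∘ Inverse.to σ
    ; pos<n = toℕ<n ∘ Inverse.to σ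
    ; pos-injective = λ {x} {y} eq → trans (sym (Inverse.strictlyInverseʳ σ x))
                        (trans (cong (Inverse.from σ) (toℕ-injective eq)) (Inverse.strictlyInverseʳ σ y))
    ; edge⇔adjacent = λ x y → mk⇔ (does-true (cycleAdjacent? n _ _) ∘ trans (sym (adj≡cycAdj x y)))
                                  (trans (adj≡cycAdj x y) ∘ dec-true (cycleAdjacent? n _ _))
    }

  cycleNumbering⇒isoCycle : CycleNumbering G → IsoCycle G
  cycleNumbering⇒isoCycle C = injective⇒↔ rank rank-injective , adj≡cycAdj
    where
    open CycleNumbering C
    rank : Fin n → Fin n
    rank x = fromℕ< (pos<n x)
    rank-injective : ∀ {x y} → rank x ≡ rank y → x ≡ y
    rank-injective eq = pos-injective (trans (sym (toℕ-fromℕ< _)) (trans (cong toℕ eq) (toℕ-fromℕ< _)))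
    adj≡cycAdj : ∀ x y → adj G x y ≡ cycAdj n (rank x) (rank y)
    adj≡cycAdj x y = trans (sym (does-≟true (adj G x y)))
      (does-⇔ (subst₂ (λ p q → Edge G x y ⇔ CycleAdjacent n p q) (sym (toℕ-fromℕ< _)) (sym (toℕ-fromℕ< _)) (edge⇔adjacent x y))
              (adj G x y ≟ᵇ true) (cycleAdjacent? n _ _))

  rotate : CycleNumbering G → CycleNumbering G
  rotate C = record
    { pos = next n ∘ pos
    ; pos<n = λ x → next<n (≤-<-trans z≤n (pos<n x))
    ; pos-injective = λ {x} {y} eq → pos-injective (next-injective (pos<n x) (pos<n y) eq)
    ; edge⇔adjacent = λ x y → mk⇔ (adjacent-next (pos<n x) (pos<n y) ∘ Equivalence.to (edge⇔adjacent x y))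
                                  (Equivalence.from (edge⇔adjacent x y) ∘ adjacent-next⁻ (pos<n x) (pos<n y))
    }
    where open CycleNumbering C

  root-at : CycleNumbering G → (v : Fin n) → Σ (CycleNumbering G) λ C → CycleNumbering.pos C v ≡ 0
  root-at C v = go C (n ∸ suc (pos v)) (m+[n∸m]≡n (pos<n v))
    where
    open CycleNumbering C
    go : (C′ : CycleNumbering G) → ∀ d → suc (CycleNumbering.pos C′ v + d) ≡ n →
         Σ (CycleNumbering G) λ C → CycleNumbering.pos C v ≡ 0
    go C′ zero top = rotate C′ , next-top (trans (cong suc (sym (+-identityʳ _))) top)
    go C′ (suc d) top = go (rotate C′) d (trans (cong suc (trans (cong (_+ d) (next-below below)) (sym (+-suc _ d)))) top)
      where
      below : suc (CycleNumbering.pos C′ v) < n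
      below = ≤-<-trans (s≤s (m≤m+n _ d)) (≤-reflexive (trans (cong suc (sym (+-suc _ d))) top))

module RootedCycle {G : Graph n} (C : CycleNumbering G) {v : Fin n} (root : CycleNumbering.pos C v ≡ 0) (n≥3 : 3 ≤ n) where
  open CycleNumbering C

  -- vertex-at p is the junk value v for p ≥ n.
  vertex-at : ℕ → Fin n
  vertex-at p with p <? n
  ... | yes p<n = proj₁ (injective-below⇒surjective pos pos<n pos-injective p<n)
  ... | no _ = v

  pos-vertex-at : ∀ {p} → p < n → pos (vertex-at p) ≡ p
  pos-vertex-at {p} p<n with p <? n
  ... | yes p<n′ = proj₂ (injective-below⇒surjective pos pos<n pos-injective p<n′)
  ... | no p≮n = contradiction p<n p≮n

  0<n : 0 < n
  0<n = ≤-trans (s≤s z≤n) n≥3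

  n∸1<n : n ∸ 1 < n
  n∸1<n = ≤-reflexive (suc[m∸1]≡m 0<n)

  0<n∸1 : 0 < n ∸ 1
  0<n∸1 = ≤-trans (s≤s z≤n) (≤-pred (subst (3 ≤_) (sym (suc[m∸1]≡m 0<n)) n≥3))

  sink : Fin n
  sink = vertex-at (n ∸ 1)

  pos-sink : pos sink ≡ n ∸ 1
  pos-sink = pos-vertex-at n∸1<n

  down up : Fin n → Fin n
  down x = vertex-at (pos x ∸ 1)
  up x = vertex-at (suc (pos x))

  pos-down : ∀ x → 0 < pos x → suc (pos (down x)) ≡ pos x
  pos-down x 0<x = trans (cong suc (pos-vertex-at (≤-<-trans (m∸n≤m (pos x) 1) (pos<n x)))) (suc[m∸1]≡m 0<x)

  edge : ∀ x y → CycleAdjacent n (pos x) (pos y) → Edge G x y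
  edge x y = Equivalence.from (edge⇔adjacent x y)

  st-numbering : STNumbering G v
  st-numbering = record
    { pos = pos ; pos<n = pos<n ; pos-injective = pos-injective ; pos-source = root
    ; sink = sink
    ; pos-sink = trans (cong suc pos-sink) (suc[m∸1]≡m 0<n)
    ; source-sink = edge v sink (inj₂ (inj₂ (inj₁ (root , pos-sink))))
    ; down = down ; up = up
    ; down-edge = λ x 0<x → edge x (down x) (inj₂ (inj₁ (sym (pos-down x 0<x))))
    ; down-lower = λ x 0<x → ≤-reflexive (pos-down x 0<x)
    ; down-sink = pos-down sink (subst (0 <_) (sym pos-sink) 0<n∸1)
    ; up-edge = λ x x<top → edge x (up x) (inj₁ (pos-vertex-at x<top))
    ; up-higher = λ x x<top → ≤-reflexive (sym (pos-vertex-at x<top))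
    }

-- Equality forces a cycle

-- If f = 1 + n(n+1)/2 the family contains every connected subgraph through v. Hence G minus an
-- edge other than the e_a, and the subgraph spanned by positions ≤ pos (down x) together with x
-- when down x is not the vertex just below x, cannot be connected subgraphs through v; but they are.
module Tight {n : ℕ} {G : Graph n} {v : Fin n} (S : STNumbering G v) (n≥3 : 3 ≤ n) {xs : List (SubData n)}
             (members : ∀ H → H ∈ xs ⇔ ConnSubContaining G v H) (tight : length xs ≡ suc (triangle n)) where
  open STNumbering S
  open Family S n≥3

  in-family : ∀ {H} → ConnSubContaining G v H → ¬ (∀ i → family i ≢ H)
  in-family {H} H-connected H-new =
    <-irrefl (sym tight) (injection-into-list⇒≤ xs extended extended-injective extended∈xs)
    where
    extended : Fin (suc (suc (triangle n))) → SubData n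
    extended fzero = H
    extended (fsuc i) = family i
    extended-injective : Injective _≡_ _≡_ extended
    extended-injective {fzero} {fzero} _ = refl
    extended-injective {fzero} {fsuc j} eq = contradiction (sym eq) (H-new j)
    extended-injective {fsuc i} {fzero} eq = contradiction eq (H-new i)
    extended-injective {fsuc i} {fsuc j} eq = cong fsuc (family-injective eq)
    extended∈xs : ∀ i → extended i ∈ xs
    extended∈xs fzero = Equivalence.from (members H) H-connected
    extended∈xs (fsuc i) = Equivalence.from (members (family i)) (family-connected i)

  module WithoutEdge {x₀ y₀ : Fin n} (e₀ : Edge G x₀ y₀) (never-removed : ∀ {a} → a < n → ¬ Removed a x₀ y₀) where
    IsE₀ : Fin n → Fin n → Set
    IsE₀ x y = (x ≡ x₀ × y ≡ y₀) ⊎ (x ≡ y₀ × y ≡ x₀)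

    Remaining : Fin n → Fin n → Set
    Remaining x y = Edge G x y × ¬ IsE₀ x y

    remaining? : ∀ x y → Dec (Remaining x y)
    remaining? x y = adj G x y ≟ᵇ true ×-dec ¬? ((x ≟ᶠ x₀ ×-dec y ≟ᶠ y₀) ⊎-dec (x ≟ᶠ y₀ ×-dec y ≟ᶠ x₀))

    remaining-sym : ∀ {x y} → Remaining x y → Remaining y x
    remaining-sym (e , ¬e₀) = edge-sym G e , λ { (inj₁ (y≡ , x≡)) → ¬e₀ (inj₂ (x≡ , y≡))
                                               ; (inj₂ (y≡ , x≡)) → ¬e₀ (inj₁ (x≡ , y≡)) }

    G-e₀ : SubData n
    G-e₀ = subgraph {V = λ _ → ⊤} (λ _ → yes tt) remaining?

    connected : ConnSubContaining G v G-e₀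
    connected = subgraph-connected {V = λ _ → ⊤} (λ _ → yes tt) remaining? G remaining-sym (λ (e , _) → e , tt , tt) tt
      (λ x _ → walk-down (λ _ → ⊤) (λ y _ 0<y → (down-edge y 0<y , down-edge≢e₀ y 0<y) , tt) x tt)
      where
      down-edge≢e₀ : ∀ y → 0 < pos y → ¬ IsE₀ y (down y)
      down-edge≢e₀ y 0<y is-e₀ = never-removed (≤-<-trans (m∸n≤m (pos y) 1) (pos<n y)) (removed is-e₀)
        where
        removed-down : RemovedEdge (pos y ∸ 1) y (down y)
        removed-down = inj₁ (sym (suc[m∸1]≡m 0<y) , refl)
        removed : IsE₀ y (down y) → Removed (pos y ∸ 1) x₀ y₀
        removed (inj₁ (refl , refl)) = inj₁ removed-down
        removed (inj₂ (refl , refl)) = inj₂ removed-down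

    new : ∀ i → family i ≢ G-e₀
    new fzero eq = proj₂ (subgraph-≡⇒E eq e₀) (inj₁ (refl , refl))
    new (fsuc i) eq with pair n i | pair-ordered n i
    ... | a , b | a≤b , b<n with m≤n⇒m<n∨m≡n a≤b
    ...   | inj₁ a<b = ¬all-kept a<b b<n λ x → subgraph-≡⇒V (sym eq) tt
    ...   | inj₂ refl = proj₂ (subgraph-≡⇒E eq (e₀ , kept-all a x₀ , kept-all a y₀ , λ (_ , r) → never-removed b<n r))
                          (inj₁ (refl , refl))

  edge-removed : ∀ {x y} → Edge G x y → ∃ λ a → Removed a x y
  edge-removed {x} {y} e with any? (λ (a : Fin n) → removed? (toℕ a) x y)
  ... | yes (a , r) = toℕ a , r
  ... | no none = contradiction W.new (in-family W.connected)
    where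
    never-removed : ∀ {a} → a < n → ¬ Removed a x y
    never-removed a<n r = none (fromℕ< a<n , subst (λ c → Removed c x y) (sym (toℕ-fromℕ< a<n)) r)
    module W = WithoutEdge e never-removed

  module Shortcut {x : Fin n} (0<x : 0 < pos x) (skips : suc (pos (down x)) < pos x) (x<top : suc (pos x) < n) where
    InX : Fin n → Set
    InX y = pos y ≤ pos (down x) ⊎ y ≡ x

    inX? : ∀ y → Dec (InX y)
    inX? y = pos y ≤? pos (down x) ⊎-dec y ≟ᶠ x

    EdgeX : Fin n → Fin n → Set
    EdgeX y z = Edge G y z × InX y × InX z

    edgeX? : ∀ y z → Dec (EdgeX y z)
    edgeX? y z = adj G y z ≟ᵇ true ×-dec inX? y ×-dec inX? z

    X : SubData n
    X = subgraph inX? edgeX?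

    connected : ConnSubContaining G v X
    connected = subgraph-connected inX? edgeX? G (λ (e , y∈ , z∈) → edge-sym G e , z∈ , y∈) (λ e → e)
      (inj₁ (subst (_≤ pos (down x)) (sym pos-source) z≤n)) to-source
      where
      descend : ∀ y → pos y ≤ pos (down x) → 0 < pos y → EdgeX y (down y) × pos (down y) ≤ pos (down x)
      descend y y≤ 0<y = (down-edge y 0<y , inj₁ y≤ , inj₁ down≤) , down≤
        where
        down≤ : pos (down y) ≤ pos (down x)
        down≤ = ≤-trans (<⇒≤ (down-lower y 0<y)) y≤
      to-source : ∀ y → InX y → Walk EdgeX y v
      to-source y (inj₁ y≤) = walk-down (λ z → pos z ≤ pos (down x)) descend y y≤
      to-source y (inj₂ refl) = step (down-edge x 0<x , inj₂ refl , inj₁ ≤-refl)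
                                     (walk-down (λ z → pos z ≤ pos (down x)) descend (down x) ≤-refl)

    above-x : Fin n
    above-x = at x<top

    above-x∉X : ¬ InX above-x
    above-x∉X (inj₁ above≤) =
      <-irrefl refl (<-trans (down-lower x 0<x) (<-≤-trans (n<1+n (pos x)) (subst (_≤ pos (down x)) (pos-at x<top) above≤)))
    above-x∉X (inj₂ above≡x) = <-irrefl (sym (trans (sym (pos-at x<top)) (cong pos above≡x))) (n<1+n (pos x))

    below<n : suc (pos (down x)) < n
    below<n = <-trans skips (pos<n x)

    below-x : Fin n
    below-x = at below<n

    below-x∉X : ¬ InX below-x
    below-x∉X (inj₁ below≤) = <-irrefl refl (subst (_≤ pos (down x)) (pos-at below<n) below≤)
    below-x∉X (inj₂ below≡x) = <-irrefl (trans (sym (pos-at below<n)) (cong pos below≡x)) skips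

    new : ∀ i → family i ≢ X
    new fzero eq = above-x∉X (subgraph-≡⇒V eq tt)
    new (fsuc i) eq with pair n i | pair-ordered n i
    ... | a , b | a≤b , b<n with m≤n⇒m<n∨m≡n a≤b
    ...   | inj₂ refl = above-x∉X (subgraph-≡⇒V eq (kept-all a above-x))
    ...   | inj₁ a<b with subgraph-≡⇒V (sym eq) (inj₂ refl)
    ...     | inj₁ x≤a = below-x∉X (subgraph-≡⇒V eq (inj₁ (≤-trans (≤-reflexive (pos-at below<n)) (≤-trans (<⇒≤ skips) x≤a))))
    ...     | inj₂ b<x = above-x∉X (subgraph-≡⇒V eq (inj₂ (<-trans b<x (subst (pos x <_) (sym (pos-at x<top)) (n<1+n _)))))

  down-exact : ∀ x → 0 < pos x → suc (pos (down x)) ≡ pos x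
  down-exact x 0<x with x ≟ᶠ sink
  ... | yes refl = down-sink
  ... | no x≢sink with suc (pos (down x)) ≟ pos x
  ...   | yes exact = exact
  ...   | no skips = contradiction Sc.new (in-family Sc.connected)
    where module Sc = Shortcut 0<x (≤∧≢⇒< (down-lower x 0<x) skips) (below-sink x≢sink)

  cycle-numbering : CycleNumbering G
  cycle-numbering = record { pos = pos ; pos<n = pos<n ; pos-injective = pos-injective
                           ; edge⇔adjacent = λ x y → mk⇔ edge⇒adjacent (adjacent⇒edge x y) }
    where
    pos-sink-top : pos sink ≡ n ∸ 1
    pos-sink-top = cong (_∸ 1) pos-sink

    down-is : ∀ {x y} → pos x ≡ suc (pos y) → down x ≡ y
    down-is {x} x≡1+y = pos-injective (suc-injective (trans (down-exact x (subst (0 <_) (sym x≡1+y) z<s)) x≡1+y))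

    removedEdge⇒adjacent : ∀ {a x y} → RemovedEdge a x y → CycleAdjacent n (pos x) (pos y)
    removedEdge⇒adjacent {x = x} (inj₁ (x≡1+a , refl)) = inj₂ (inj₁ (sym (down-exact x (subst (0 <_) (sym x≡1+a) z<s))))
    removedEdge⇒adjacent (inj₂ (_ , refl , refl)) = inj₂ (inj₂ (inj₁ (pos-source , pos-sink-top)))

    edge⇒adjacent : ∀ {x y} → Edge G x y → CycleAdjacent n (pos x) (pos y)
    edge⇒adjacent e with edge-removed e
    ... | _ , inj₁ r = removedEdge⇒adjacent r
    ... | _ , inj₂ r = adjacent-sym {n} (removedEdge⇒adjacent r)

    adjacent⇒edge : ∀ x y → CycleAdjacent n (pos x) (pos y) → Edge G x y
    adjacent⇒edge x y (inj₁ y≡1+x) = edge-sym G (subst (Edge G y) (down-is y≡1+x) (down-edge y (subst (0 <_) (sym y≡1+x) z<s)))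
    adjacent⇒edge x y (inj₂ (inj₁ x≡1+y)) = subst (Edge G x) (down-is x≡1+y) (down-edge x (subst (0 <_) (sym x≡1+y) z<s))
    adjacent⇒edge x y (inj₂ (inj₂ (inj₁ (x≡0 , y≡top)))) =
      subst₂ (Edge G) (sym (pos≡0⇒source x≡0)) (pos-injective (trans pos-sink-top (sym y≡top))) source-sink
    adjacent⇒edge x y (inj₂ (inj₂ (inj₂ (y≡0 , x≡top)))) =
      edge-sym G (subst₂ (Edge G) (sym (pos≡0⇒source y≡0)) (pos-injective (trans pos-sink-top (sym x≡top))) source-sink)

-- Connected subgraphs of a cycle

-- With v at position 0, the edge Removed c joins positions c and next c. Lacking the edges c₁ < c₂
-- cuts the arc (c₁, c₂] off from v. So a connected subgraph through v with all vertices lacks at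
-- most one edge, and otherwise its missing vertices fill the positions from the first to the last.
module Classification {n : ℕ} {G : Graph n} (C : CycleNumbering G) {v : Fin n}
                      (root : CycleNumbering.pos C v ≡ 0) (n≥3 : 3 ≤ n) where
  open CycleNumbering C
  open RootedCycle C root n≥3 using (st-numbering; sink; pos-sink; down; pos-down)
  open Family st-numbering n≥3

  removedEdge-positions : ∀ {c x y} → RemovedEdge c x y → pos y ≡ c × pos x ≡ next n c
  removedEdge-positions {c} {x} (inj₁ (x≡1+c , refl)) =
    suc-injective (trans (pos-down x (subst (0 <_) (sym x≡1+c) z<s)) x≡1+c) ,
    trans x≡1+c (sym (next-below (subst (_< n) x≡1+c (pos<n x))))
  removedEdge-positions (inj₂ (1+c≡n , refl , refl)) =
    trans pos-sink (cong (_∸ 1) (sym 1+c≡n)) , trans root (sym (next-top 1+c≡n))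

  positions⇒removedEdge : ∀ {c x y} → pos y ≡ c → pos x ≡ next n c → RemovedEdge c x y
  positions⇒removedEdge {c} {x} {y} y≡c x≡next with m≤n⇒m<n∨m≡n (subst (_< n) y≡c (pos<n y))
  ... | inj₁ 1+c<n = inj₁ (x≡1+c , pos-injective (trans y≡c (suc-injective (sym (trans (pos-down x 0<x) x≡1+c)))))
    where
    x≡1+c : pos x ≡ suc c
    x≡1+c = trans x≡next (next-below 1+c<n)
    0<x : 0 < pos x
    0<x = subst (0 <_) (sym x≡1+c) z<s
  ... | inj₂ 1+c≡n = inj₂ (1+c≡n , pos-injective (trans x≡next (trans (next-top 1+c≡n) (sym root))) ,
                         pos-injective (trans y≡c (sym (trans pos-sink (cong (_∸ 1) (sym 1+c≡n))))))

  edge⇒removed : ∀ {x y} → Edge G x y → ∃ λ c → Removed c x y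
  edge⇒removed {x} {y} e with Equivalence.to (adjacent⇔successor (pos<n x) (pos<n y)) (Equivalence.to (edge⇔adjacent x y) e)
  ... | inj₁ y≡next = pos x , inj₂ (positions⇒removedEdge refl y≡next)
  ... | inj₂ x≡next = pos y , inj₁ (positions⇒removedEdge refl x≡next)

  removed-endpoints : ∀ {c x y} → Removed c x y →
                      ∃ λ lo → ∃ λ hi → pos lo ≡ c × pos hi ≡ next n c × (x ≡ hi × y ≡ lo ⊎ x ≡ lo × y ≡ hi)
  removed-endpoints (inj₁ r) = _ , _ , proj₁ (removedEdge-positions r) , proj₂ (removedEdge-positions r) , inj₁ (refl , refl)
  removed-endpoints (inj₂ r) = _ , _ , proj₁ (removedEdge-positions r) , proj₂ (removedEdge-positions r) , inj₂ (refl , refl)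

  removed<n : ∀ {c x y} → Removed c x y → c < n
  removed<n r with removed-endpoints r
  ... | lo , _ , lo≡c , _ = subst (_< n) lo≡c (pos<n lo)

  removed-pair : ∀ {c x y x′ y′} → Removed c x y → Removed c x′ y′ → (x ≡ x′ × y ≡ y′) ⊎ (x ≡ y′ × y ≡ x′)
  removed-pair r r′ with removed-endpoints r | removed-endpoints r′
  ... | lo , hi , lo≡c , hi≡next , o | lo′ , hi′ , lo′≡c , hi′≡next , o′
    with pos-injective (trans lo≡c (sym lo′≡c)) | pos-injective (trans hi≡next (sym hi′≡next))
  ... | refl | refl with o | o′
  ...   | inj₁ (refl , refl) | inj₁ (refl , refl) = inj₁ (refl , refl)
  ...   | inj₁ (refl , refl) | inj₂ (refl , refl) = inj₂ (refl , refl)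
  ...   | inj₂ (refl , refl) | inj₁ (refl , refl) = inj₂ (refl , refl)
  ...   | inj₂ (refl , refl) | inj₂ (refl , refl) = inj₁ (refl , refl)

  endpoints-satisfy : ∀ {P : Fin n → Set} {x y lo hi} → x ≡ hi × y ≡ lo ⊎ x ≡ lo × y ≡ hi → P x → P y → P lo × P hi
  endpoints-satisfy (inj₁ (refl , refl)) Px Py = Py , Px
  endpoints-satisfy (inj₂ (refl , refl)) Px Py = Px , Py

  Arc : ℕ → ℕ → ℕ → Set
  Arc a₁ a₂ p = a₁ < p × p ≤ a₂

  arc-next : ∀ {a₁ a₂ c} → c ≢ a₁ → c ≢ a₂ → a₂ < n → Arc a₁ a₂ c ⇔ Arc a₁ a₂ (next n c)
  arc-next {a₁} {a₂} {c} c≢a₁ c≢a₂ a₂<n = mk⇔ forward backward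
    where
    forward : Arc a₁ a₂ c → Arc a₁ a₂ (next n c)
    forward (a₁<c , c≤a₂) = subst (Arc a₁ a₂) (sym (next-below (≤-<-trans c<a₂ a₂<n))) (<-trans a₁<c (n<1+n c) , c<a₂)
      where
      c<a₂ : c < a₂
      c<a₂ = ≤∧≢⇒< c≤a₂ c≢a₂
    backward : Arc a₁ a₂ (next n c) → Arc a₁ a₂ c
    backward arc with next-cases {n} c
    ... | inj₁ (_ , next≡1+c) with subst (Arc a₁ a₂) next≡1+c arc
    ...   | a₁<1+c , 1+c≤a₂ = ≤∧≢⇒< (≤-pred a₁<1+c) (c≢a₁ ∘ sym) , ≤-trans (n≤1+n c) 1+c≤a₂
    backward arc | inj₂ (_ , next≡0) = contradiction (proj₁ (subst (Arc a₁ a₂) next≡0 arc)) λ ()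

  arc-crossing : ∀ {a₁ a₂ c} → a₁ < a₂ → a₂ < n → c ≡ a₁ ⊎ c ≡ a₂ →
                 (Arc a₁ a₂ c × ¬ Arc a₁ a₂ (next n c)) ⊎ (¬ Arc a₁ a₂ c × Arc a₁ a₂ (next n c))
  arc-crossing {a₁} {a₂} a₁<a₂ a₂<n (inj₁ refl) =
    inj₂ ((λ (a₁<a₁ , _) → <-irrefl refl a₁<a₁) , subst (Arc a₁ a₂) (sym (next-below (≤-<-trans a₁<a₂ a₂<n))) (n<1+n a₁ , a₁<a₂))
  arc-crossing {a₁} {a₂} a₁<a₂ a₂<n (inj₂ refl) = inj₁ ((a₁<a₂ , ≤-refl) , outside)
    where
    outside : ¬ Arc a₁ a₂ (next n a₂)
    outside arc with next-cases {n} a₂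
    ... | inj₁ (_ , next≡1+a₂) = <-irrefl refl (proj₂ (subst (Arc a₁ a₂) next≡1+a₂ arc))
    ... | inj₂ (_ , next≡0) = contradiction (proj₁ (subst (Arc a₁ a₂) next≡0 arc)) λ ()

  module Subgraph {H : SubData n} (H-connected : ConnSubContaining G v H) where
    private
      H-symmetric : ∀ x y → lookup (lookup (proj₂ H) x) y ≡ lookup (lookup (proj₂ H) y) x
      H-symmetric = proj₁ (proj₁ H-connected)
      H-in-G : ∀ x y → InE H x y → Edge G x y × InV H x × InV H y
      H-in-G = proj₂ (proj₁ H-connected)
      H-walk : ∀ x y → InV H x → InV H y → Walk (InE H) x y
      H-walk = proj₂ (proj₁ (proj₂ H-connected))
      v∈H : InV H v
      v∈H = proj₂ (proj₂ H-connected)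

    InE-sym : ∀ {x y} → InE H x y → InE H y x
    InE-sym {x} {y} xy∈H = trans (H-symmetric y x) xy∈H

    Lacks : ℕ → Set
    Lacks c = ∀ {x y} → InE H x y → ¬ Removed c x y

    arc-invariant : ∀ {a₁ a₂ x y} → a₂ < n → Lacks a₁ → Lacks a₂ → Walk (InE H) x y → Arc a₁ a₂ (pos x) → Arc a₁ a₂ (pos y)
    arc-invariant {a₁} {a₂} a₂<n lacks₁ lacks₂ = walk-preserves (Arc a₁ a₂ ∘ pos) along-edge
      where
      along-edge : ∀ {x y} → InE H x y → Arc a₁ a₂ (pos x) → Arc a₁ a₂ (pos y)
      along-edge xy∈H with edge⇒removed (proj₁ (H-in-G _ _ xy∈H))
      ... | c , r with removed-endpoints r
      ...   | lo , hi , lo≡c , hi≡next , ends = transport ends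
        where
        c≢a₁ : c ≢ a₁
        c≢a₁ refl = lacks₁ xy∈H r
        c≢a₂ : c ≢ a₂
        c≢a₂ refl = lacks₂ xy∈H r
        lo⇔hi : Arc a₁ a₂ (pos lo) ⇔ Arc a₁ a₂ (pos hi)
        lo⇔hi = subst₂ (λ p q → Arc a₁ a₂ p ⇔ Arc a₁ a₂ q) (sym lo≡c) (sym hi≡next) (arc-next c≢a₁ c≢a₂ a₂<n)
        transport : ∀ {x y} → x ≡ hi × y ≡ lo ⊎ x ≡ lo × y ≡ hi → Arc a₁ a₂ (pos x) → Arc a₁ a₂ (pos y)
        transport (inj₁ (refl , refl)) = Equivalence.from lo⇔hi
        transport (inj₂ (refl , refl)) = Equivalence.to lo⇔hi

    arc-closed : ∀ {a₁ a₂ x y} → a₂ < n → Lacks a₁ → Lacks a₂ → InV H x → InV H y → Arc a₁ a₂ (pos x) → Arc a₁ a₂ (pos y)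
    arc-closed a₂<n lacks₁ lacks₂ x∈H y∈H = arc-invariant a₂<n lacks₁ lacks₂ (H-walk _ _ x∈H y∈H)

    cut : ∀ {a₁ a₂ c x y} → a₁ < a₂ → a₂ < n → Lacks a₁ → Lacks a₂ → Removed c x y → c ≡ a₁ ⊎ c ≡ a₂ →
          InV H x → InV H y → ⊥
    cut {a₁} {a₂} a₁<a₂ a₂<n lacks₁ lacks₂ r c≡ x∈H y∈H with removed-endpoints r
    ... | lo , hi , refl , hi≡next , ends = crossing (arc-crossing a₁<a₂ a₂<n c≡)
      where
      ends∈H : InV H lo × InV H hi
      ends∈H = endpoints-satisfy {P = InV H} ends x∈H y∈H
      lo→hi : Arc a₁ a₂ (pos lo) → Arc a₁ a₂ (pos hi)
      lo→hi = arc-closed a₂<n lacks₁ lacks₂ (proj₁ ends∈H) (proj₂ ends∈H)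
      hi→lo : Arc a₁ a₂ (pos hi) → Arc a₁ a₂ (pos lo)
      hi→lo = arc-closed a₂<n lacks₁ lacks₂ (proj₂ ends∈H) (proj₁ ends∈H)
      crossing : (Arc a₁ a₂ (pos lo) × ¬ Arc a₁ a₂ (next n (pos lo))) ⊎
                 (¬ Arc a₁ a₂ (pos lo) × Arc a₁ a₂ (next n (pos lo))) → ⊥
      crossing (inj₁ (lo-in , hi-out)) = hi-out (subst (Arc a₁ a₂) hi≡next (lo→hi lo-in))
      crossing (inj₂ (lo-out , hi-in)) = lo-out (hi→lo (subst (Arc a₁ a₂) (sym hi≡next) hi-in))

    cut′ : ∀ {c c′ x y} → c ≢ c′ → c′ < n → Lacks c → Lacks c′ → Removed c x y → InV H x → InV H y → ⊥
    cut′ {c} {c′} c≢c′ c′<n lacks lacks′ r x∈H y∈H with <-cmp c c′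
    ... | tri< c<c′ _ _ = cut c<c′ c′<n lacks lacks′ r (inj₁ refl) x∈H y∈H
    ... | tri≈ _ c≡c′ _ = c≢c′ c≡c′
    ... | tri> _ _ c′<c = cut c′<c (removed<n r) lacks′ lacks r (inj₂ refl) x∈H y∈H

    missing-endpoint : ∀ {r c x y} → ¬ InV H r → pos r ≡ c ⊎ pos r ≡ next n c → Removed c x y → InV H x → InV H y → ⊥
    missing-endpoint r∉H r-end removed x∈H y∈H with removed-endpoints removed
    ... | lo , hi , lo≡c , hi≡next , ends with endpoints-satisfy {P = InV H} ends x∈H y∈H | r-end
    ...   | lo∈H , _ | inj₁ r≡c = r∉H (subst (InV H) (pos-injective (trans lo≡c (sym r≡c))) lo∈H)
    ...   | _ , hi∈H | inj₂ r≡next = r∉H (subst (InV H) (pos-injective (trans hi≡next (sym r≡next))) hi∈H)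

    missing-lacks : ∀ {r c} → ¬ InV H r → pos r ≡ c ⊎ pos r ≡ next n c → Lacks c
    missing-lacks r∉H r-end {x} {y} xy∈H removed =
      missing-endpoint r∉H r-end removed (proj₁ (proj₂ (H-in-G x y xy∈H))) (proj₂ (proj₂ (H-in-G x y xy∈H)))

    missing-edge-lacks : ∀ {c x₀ y₀} → ¬ InE H x₀ y₀ → Removed c x₀ y₀ → Lacks c
    missing-edge-lacks x₀y₀∉H r₀ xy∈H r with removed-pair r r₀
    ... | inj₁ (refl , refl) = x₀y₀∉H xy∈H
    ... | inj₂ (refl , refl) = x₀y₀∉H (InE-sym xy∈H)

    InV? : ∀ x → Dec (InV H x)
    InV? x = lookup (proj₁ H) x ≟ᵇ true

    InE? : ∀ x y → Dec (InE H x y)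
    InE? x y = lookup (lookup (proj₂ H) x) y ≟ᵇ true

    all-vertices-case : (∀ x → InV H x) → ∃ λ i → family i ≡ H
    all-vertices-case all∈H with any? (λ x → any? (λ y → adj G x y ≟ᵇ true ×-dec ¬? (InE? x y)))
    ... | no none = fzero , subgraph-≗ H (λ x → mk⇔ (λ _ → all∈H x) (λ _ → tt))
                                         (λ x y → mk⇔ (edge⇒InE x y) (λ xy∈H → proj₁ (H-in-G x y xy∈H)))
      where
      edge⇒InE : ∀ x y → Edge G x y → InE H x y
      edge⇒InE x y e with InE? x y
      ... | yes xy∈H = xy∈H
      ... | no xy∉H = contradiction (x , y , e , xy∉H) none
    ... | yes (x₀ , y₀ , e₀ , x₀y₀∉H) with edge⇒removed e₀
    ...   | c₀ , r₀ with member-in-family (≤-refl {c₀}) (removed<n r₀)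
    ...     | i , family-i = i , trans family-i (subgraph-≗ H (λ x → mk⇔ (λ _ → all∈H x) (λ _ → kept-all c₀ x))
                                                         (λ x y → mk⇔ (kept⇒InE x y) (InE⇒kept x y)))
      where
      lacks₀ : Lacks c₀
      lacks₀ = missing-edge-lacks x₀y₀∉H r₀
      InE⇒kept : ∀ x y → InE H x y → KeptEdge c₀ c₀ x y
      InE⇒kept x y xy∈H = proj₁ (H-in-G x y xy∈H) , kept-all c₀ x , kept-all c₀ y , λ (_ , r) → lacks₀ xy∈H r
      kept⇒InE : ∀ x y → KeptEdge c₀ c₀ x y → InE H x y
      kept⇒InE x y (e , _ , _ , not-removed) with InE? x y
      ... | yes xy∈H = xy∈H
      ... | no xy∉H with edge⇒removed e
      ...   | c , r with c ≟ c₀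
      ...     | yes refl = contradiction (refl , r) not-removed
      ...     | no c≢c₀ = ⊥-elim (cut′ c≢c₀ (removed<n r₀) (missing-edge-lacks xy∉H r) lacks₀ r (all∈H x) (all∈H y))

    Missing : ℕ → Set
    Missing p = ∃ λ w → pos w ≡ p × ¬ InV H w

    missing? : ∀ p → Dec (Missing p)
    missing? p = any? λ w → pos w ≟ p ×-dec ¬? (InV? w)

    present : ∀ x → ¬ Missing (pos x) → InV H x
    present x not-missing with InV? x
    ... | yes x∈H = x∈H
    ... | no x∉H = contradiction (x , refl , x∉H) not-missing

    present-at : ∀ {w p} → pos w ≡ p → ¬ InV H w → ∀ {x} → InV H x → pos x ≢ p
    present-at w≡p w∉H x∈H x≡p = w∉H (subst (InV H) (pos-injective (trans x≡p (sym w≡p))) x∈H)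

    module MissingVertex {m M : ℕ} {wₘ w_M : Fin n}
                         (wₘ≡m : pos wₘ ≡ m) (wₘ∉H : ¬ InV H wₘ) (least : ∀ {p} → Missing p → m ≤ p)
                         (w_M≡M : pos w_M ≡ M) (w_M∉H : ¬ InV H w_M) (greatest : ∀ {p} → Missing p → p ≤ M) where

      0<m : 0 < m
      0<m = n≢0⇒n>0 λ m≡0 → present-at wₘ≡m wₘ∉H v∈H (trans root (sym m≡0))

      M<n : M < n
      M<n = subst (_< n) w_M≡M (pos<n w_M)

      a<m : m ∸ 1 < m
      a<m = ≤-reflexive (suc[m∸1]≡m 0<m)

      m≤M : m ≤ M
      m≤M = greatest (wₘ , wₘ≡m , wₘ∉H)

      a<M : m ∸ 1 < M
      a<M = <-≤-trans a<m m≤M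

      lacks-m : Lacks m
      lacks-m = missing-lacks wₘ∉H (inj₁ wₘ≡m)

      kept⇒present : ∀ x → Kept (m ∸ 1) M x → InV H x
      kept⇒present x (inj₁ x≤a) = present x λ missing → <-irrefl refl (<-≤-trans (≤-<-trans x≤a a<m) (least missing))
      kept⇒present x (inj₂ M<x) = present x λ missing → <-irrefl refl (<-≤-trans M<x (greatest missing))

      inside-gap-absent : ∀ {x} → m < pos x → pos x < M → ¬ InV H x
      inside-gap-absent {x} m<x x<M x∈H = n≮0 (subst (m <_) root (proj₁ (arc-closed M-1<n lacks-m lacks-M-1 x∈H v∈H (m<x , x≤M-1))))
        where
        1+[M-1]≡M : suc (M ∸ 1) ≡ M
        1+[M-1]≡M = suc[m∸1]≡m (≤-<-trans z≤n x<M)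
        M-1<n : M ∸ 1 < n
        M-1<n = ≤-<-trans (m∸n≤m M 1) M<n
        x≤M-1 : pos x ≤ M ∸ 1
        x≤M-1 = ≤-pred (subst (pos x <_) (sym 1+[M-1]≡M) x<M)
        lacks-M-1 : Lacks (M ∸ 1)
        lacks-M-1 = missing-lacks w_M∉H (inj₂ (trans w_M≡M (sym (trans (next-below (subst (_< n) (sym 1+[M-1]≡M) M<n)) 1+[M-1]≡M))))

      present⇒kept : ∀ x → InV H x → Kept (m ∸ 1) M x
      present⇒kept x x∈H with pos x ≤? m ∸ 1 | M <? pos x
      ... | yes x≤a | _ = inj₁ x≤a
      ... | no _ | yes M<x = inj₂ M<x
      ... | no x≰a | no M≮x = ⊥-elim (inside-gap-absent m<x x<M x∈H)
        where
        m<x : m < pos x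
        m<x = ≤∧≢⇒< (subst (_≤ pos x) (suc[m∸1]≡m 0<m) (≰⇒> x≰a)) (present-at wₘ≡m wₘ∉H x∈H ∘ sym)
        x<M : pos x < M
        x<M = ≤∧≢⇒< (≮⇒≥ M≮x) (present-at w_M≡M w_M∉H x∈H)

      kept⇒InE : ∀ x y → KeptEdge (m ∸ 1) M x y → InE H x y
      kept⇒InE x y (e , kx , ky , _) with InE? x y
      ... | yes xy∈H = xy∈H
      ... | no xy∉H with edge⇒removed e
      ...   | c , r with c ≟ m
      ...     | yes refl = ⊥-elim (missing-endpoint wₘ∉H (inj₁ wₘ≡m) r (kept⇒present x kx) (kept⇒present y ky))
      ...     | no c≢m = ⊥-elim (cut′ c≢m (≤-<-trans m≤M M<n) (missing-edge-lacks xy∉H r) lacks-m r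
                                     (kept⇒present x kx) (kept⇒present y ky))

      InE⇒kept : ∀ x y → InE H x y → KeptEdge (m ∸ 1) M x y
      InE⇒kept x y xy∈H with H-in-G x y xy∈H
      ... | e , x∈H , y∈H = e , present⇒kept x x∈H , present⇒kept y y∈H , λ (a≡M , _) → <-irrefl a≡M a<M

      in-family : ∃ λ i → family i ≡ H
      in-family with member-in-family (<⇒≤ a<M) M<n
      ... | i , family-i = i , trans family-i (subgraph-≗ H (λ x → mk⇔ (kept⇒present x) (present⇒kept x))
                                                           (λ x y → mk⇔ (kept⇒InE x y) (InE⇒kept x y)))

    classified : ∃ λ i → family i ≡ H
    classified with any? (λ w → ¬? (InV? w))
    ... | no none = all-vertices-case λ x → present x λ (w , _ , w∉H) → none (w , w∉H)
    ... | yes (w , w∉H) with minimal missing? (w , refl , w∉H)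
                           | maximal missing? (w , refl , w∉H) (λ (w′ , w′≡p , _) → subst (_< n) w′≡p (pos<n w′))
    ...   | m , (wₘ , wₘ≡m , wₘ∉H) , least | M , (w_M , w_M≡M , w_M∉H) , greatest =
      MissingVertex.in-family wₘ≡m wₘ∉H least w_M≡M w_M∉H greatest

  f-upper-bound : ∀ {k} → fEquals G v k → k ≤ suc (triangle n)
  f-upper-bound (xs , refl , xs-unique , members) =
    covered-unique-list⇒≤ xs family xs-unique λ H H∈xs → Subgraph.classified (Equivalence.to (members H) H∈xs)

proposition3p1 : (n : ℕ) → 3 ≤ n → (G : Graph n) → ConnectedGraph G → NoCutVertex G →
    (v : Fin n) → (k : ℕ) → fEquals G v k →
      (n * n + n + 2 ≤ 2 * k) × ((2 * k ≡ n * n + n + 2) ⇔ IsoCycle G)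
proposition3p1 n n≥3 G connected no-cut-vertex v k f@(xs , length≡k , _ , members) =
  lower-bound , mk⇔ equality⇒cycle cycle⇒equality
  where
  S : STNumbering G v
  S = STConstruction.st-numbering G connected no-cut-vertex v n≥3

  lower-bound : n * n + n + 2 ≤ 2 * k
  lower-bound = subst (_≤ 2 * k) (twice-suc-triangle n) (*-monoʳ-≤ 2 (Family.f-lower-bound S n≥3 f))

  equality⇒cycle : 2 * k ≡ n * n + n + 2 → IsoCycle G
  equality⇒cycle 2k≡ = cycleNumbering⇒isoCycle (Tight.cycle-numbering S n≥3 members (trans length≡k k≡))
    where
    k≡ : k ≡ suc (triangle n)
    k≡ = *-cancelˡ-≡ k _ 2 (trans 2k≡ (sym (twice-suc-triangle n)))

  cycle⇒equality : IsoCycle G → 2 * k ≡ n * n + n + 2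
  cycle⇒equality iso with root-at (isoCycle⇒cycleNumbering {G = G} iso) v
  ... | C , root = trans (cong (2 *_) (≤-antisym (Classification.f-upper-bound C root n≥3 f)
                                                  (Family.f-lower-bound (RootedCycle.st-numbering C root n≥3) n≥3 f)))
                         (twice-suc-triangle n)
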